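{- Let $n\ge1$ and $\mathbf{k}\in\mathbb{Z}^n$. For $1\le j\le i\le n-1$ let $p_{i,j},q_{i,j}\in\{1,\dots,i+1\}$. Let $A\in\mathrm{MS}(\mathbb{Z},1)\times\cdots\times\mathrm{MS}(\mathbb{Z},n)$ with $A_n=\{\!\{k_1,\dots,k_n\}\!\}$. Then there exists a sijection between $\mathrm{GGT}(\mathbf{k};\{p_{i,j}\},\{q_{i,j}\})|_{\eta_{\mathrm{row}}=A}$ and $S$ that is compatible with $\eta_{\mathrm{row}}$, where: - $S=(\emptyset,\emptyset)$ if $\mathrm{sgn}(\{p_{i,j}\},\{q_{i,j}\})=0$; - $S=\mathrm{GT}(\mathbf{k})|_{\eta_{\mathrm{row}}=A}$ if the sign is $+1$; - $S=-\mathrm{GT}(\mathbf{k})|_{\eta_{\mathrm{row}}=A}$ if the sign is $-1$.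
   Context: Signed sets $S=(S^+,S^-)$ are pairs of disjoint finite sets with support $|S|=S^+\sqcup S^-$. The opposite is $-S=(S^-,S^+)$. The restriction to a statistic value is $S|_{\eta=a}=(\{s\in S^+:\eta(s)=a\},\{s\in S^-:\eta(s)=a\})$. A sijection $\varphi:S\Rightarrow T$ is an involution on $|S|\sqcup|T|$ mapping $S^+\sqcup T^-$ onto $S^-\sqcup T^+$. It is compatible with a statistic $\eta$ if $\eta(\varphi(s))=\eta(s)$ for all $s\in|S|\sqcup|T|$. The Cartesian product is $S\times T=(S^+\times T^+\sqcup S^-\times T^-,\ S^+\times T^-\sqcup S^-\times T^+)$. The disjoint union with signed index is $\bigsqcup_{t\in T}S_t=(\bigsqcup_{t\in T^+}S_t^+\sqcup\bigsqcup_{t\in T^- }S_t^-,\ \bigsqcup_{t\in T^+}S_t^-\sqcup\bigsqcup_{t\in T^- }S_t^+)$. The signed interval $[a,b)$ is $([a,b)\cap\mathbb{Z},\emptyset)$ if $a<b$, $(\emptyset,\emptyset)$ if $a=b$, and $(\emptyset,[b,a)\cap\mathbb{Z})$ if $a>b$. $\mathrm{GGT}(k;\cdot)=(\{k\},\emptyset)$ for $n=1$. For $n\ge2$, $\mathrm{GGT}(\mathbf{k};\{p_{i,j}\},\{q_{i,j}\})=\bigsqcup_{\mathbf{l}\in\prod_{j=1}^{n-1}[k_{p_{n-1,j}},k_{q_{n-1,j}})}\mathrm{GGT}(\mathbf{l};\{p_{i,j}\},\{q_{i,j}\})$. Elements are signed triangular integer arrays with bottom row $\mathbf{k}$. $\mathrm{GT}(\mathbf{k})$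 is the case $p_{i,j}=j$, $q_{i,j}=j+1$. $\mathrm{MS}(\mathbb{Z},i)$ is the set of multisets of $i$ integers. $\eta_{\mathrm{row}}$ maps an element to the tuple of multisets of entries of its rows $1,\dots,n$. For $1\le i\le n-1$, $G_i$ is the graph on $\{1,\dots,i+1\}$ with edges $j:p_{i,j}\to q_{i,j}$, $1\le j\le i$. Define $\mathrm{sgn}(\{p_{i,j}\},\{q_{i,j}\})$ as follows. - It is $0$ if some $G_i$ (edge directions ignored) is not a tree. - Otherwise it is $\prod_{i=1}^{n-1}(-1)^{\#\{j:\,p_{i,j}=r_i(j)\}}\mathrm{sgn}(r_i)$. Here $r_i(0)\in\{1,\dots,i+1\}$ is arbitrary and $r_i(j)$ is the endpoint of edge $j$ farther from $r_i(0)$ in $G_i$. $\mathrm{sgn}(r_i)$ is the sign of the permutation $r_i-1$ of $\{0,\dots,i\}$; the product is independent of the choices. -}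

module Defs where

open import Data.Nat using (ℕ; zero; suc; _<_; _≤_)
open import Data.Integer as ℤ using (ℤ; +_; -[1+_]; _-_; _*_; -1ℤ; 1ℤ; 0ℤ)
open import Data.Integer.Properties using (≤-decTotalOrder)
open import Data.Fin as Fin using (Fin; zero; suc; inject₁)
open import Data.Fin.Properties using () renaming (_≟_ to _≟ᶠ_)
open import Data.List as List using (List; []; _∷_; _++_; map; concatMap; length; filterᵇ; allFin; upTo; lookup)
open import Data.List.Properties using (≡-dec)
open import Data.List.Relation.Binary.Permutation.Propositional using (_↭_)
open import Data.Vec as Vec using (Vec; toList)
open import Data.Product using (Σ; ∃; _×_; _,_; proj₁; proj₂)
open import Data.Sum using (_⊎_; inj₁; inj₂)
open import Data.Bool using (Bool; true; false; not; _∧_)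
open import Data.Unit using (⊤; tt)
open import Data.Empty using (⊥)
open import Function using (_∘_)
open import Function.Definitions using (Injective)
open import Relation.Nullary using (¬_; does)
open import Relation.Binary.PropositionalEquality using (_≡_)

-- A finite signed set with elements of type X is given by
-- a list of its positive elements and a list of its negative elements.
-- Elements are identified by their position in the respective list
-- (all signed sets occurring below list pairwise distinct elements).

SSet : Set → Set
SSet X = List X × List X

_⁺ _⁻ : {X : Set} → SSet X → List X
S ⁺ = proj₁ S
S ⁻ = proj₂ S

emptyS : {X : Set} → SSet X
emptyS = [] , []

oppS : {X : Set} → SSet X → SSet X
oppS (P , N) = N , P

mapS : {X Y : Set} → (X → Y) → SSet X → SSet Y
mapS f (P , N) = map f P , map f N

prodWith : {X Y Z : Set} → (X → Y → Z) → SSet X → SSet Y → SSet Z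
prodWith f (SP , SN) (TP , TN) =
  (pairs SP TP ++ pairs SN TN) , (pairs SP TN ++ pairs SN TP)
  where
  pairs : _ → _ → _
  pairs xs ys = concatMap (λ x → map (f x) ys) xs

prodV : {n : ℕ} → Vec (SSet ℤ) n → SSet (Vec ℤ n)
prodV Vec.[] = (Vec.[] ∷ []) , []
prodV (S Vec.∷ Ss) = prodWith Vec._∷_ S (prodV Ss)

⨆ : {X Y : Set} → SSet X → (X → SSet Y) → SSet Y
⨆ (TP , TN) S =
  (concatMap (_⁺ ∘ S) TP ++ concatMap (_⁻ ∘ S) TN) ,
  (concatMap (_⁻ ∘ S) TP ++ concatMap (_⁺ ∘ S) TN)

interval : ℤ → ℤ → SSet ℤ
interval a b with b - a
... | + zero    = [] , []
... | + suc n   = map (λ i → a ℤ.+ + i) (upTo (suc n)) , []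
... | -[1+ n ]  = [] , map (λ i → b ℤ.+ + i) (upTo (suc n))

restrict : {X V : Set} → ((u v : V) → Relation.Nullary.Dec (u ≡ v)) →
           (X → V) → SSet X → V → SSet X
restrict _≟_ η (P , N) a = filterᵇ (λ x → does (η x ≟ a)) P ,
                           filterᵇ (λ x → does (η x ≟ a)) N

-- Sijections.  Points of |S| ⊔ |T| are positions in the four lists.

Pt : {X : Set} → SSet X → SSet X → Set
Pt S T = (Fin (length (S ⁺)) ⊎ Fin (length (S ⁻))) ⊎
         (Fin (length (T ⁺)) ⊎ Fin (length (T ⁻)))

val : {X : Set} (S T : SSet X) → Pt S T → X
val S T (inj₁ (inj₁ i)) = lookup (S ⁺) i
val S T (inj₁ (inj₂ i)) = lookup (S ⁻) i
val S T (inj₂ (inj₁ i)) = lookup (T ⁺) i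
val S T (inj₂ (inj₂ i)) = lookup (T ⁻) i

inPlusSide : {X : Set} {S T : SSet X} → Pt S T → Bool
inPlusSide (inj₁ (inj₁ _)) = true
inPlusSide (inj₁ (inj₂ _)) = false
inPlusSide (inj₂ (inj₁ _)) = false
inPlusSide (inj₂ (inj₂ _)) = true

record CompatSijection {X V : Set} (η : X → V) (S T : SSet X) : Set where
  field
    φ        : Pt S T → Pt S T
    involutive : ∀ x → φ (φ x) ≡ x
    maps-into : ∀ x → inPlusSide {S = S} {T} x ≡ true →
                inPlusSide {S = S} {T} (φ x) ≡ false
    onto      : ∀ y → inPlusSide {S = S} {T} y ≡ false →
                ∃ λ x → inPlusSide {S = S} {T} x ≡ true × φ x ≡ y
    compatible : ∀ x → η (val S T (φ x)) ≡ η (val S T x)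

-- Parameters {p_{i,j}}, {q_{i,j}} for 1 ≤ j ≤ i ≤ m  (m = n - 1).
-- Level i = suc i' consists of two maps Fin i → Fin (i + 1)
-- (0-based: index j' stands for j = j'+1, value v' for v'+1).

Params : ℕ → Set
Params zero    = ⊤
Params (suc m) = Params m × ((Fin (suc m) → Fin (suc (suc m))) ×
                             (Fin (suc m) → Fin (suc (suc m))))

-- the parameters of Gelfand–Tsetlin patterns: p_{i,j} = j, q_{i,j} = j+1
GTParams : (m : ℕ) → Params m
GTParams zero    = tt
GTParams (suc m) = GTParams m , (inject₁ , suc)

-- Generalized Gelfand–Tsetlin patterns.  An element is the list of its
-- rows (row 1 first, row n = k last), each row a list of integers.

Array : Set
Array = List (List ℤ)

GGT : (m : ℕ) → Vec ℤ (suc m) → Params m → SSet Array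
GGT zero    k         _              = ((toList k ∷ []) ∷ []) , []
GGT (suc m) k (ps , (p , q)) =
  mapS (λ rows → rows ++ (toList k ∷ []))
    (⨆ (prodV (Vec.tabulate λ j → interval (Vec.lookup k (p j)) (Vec.lookup k (q j))))
       (λ l → GGT m l ps))

GT : (m : ℕ) → Vec ℤ (suc m) → SSet Array
GT m k = GGT m k (GTParams m)

-- Multisets of integers.  A multiset of i integers is given by a vector
-- listing its elements; its canonical form is the sorted list.

open import Data.List.Sort ≤-decTotalOrder using (sort)

MS : ℕ → Set
MS i = Vec ℤ i

canonMS : List ℤ → List ℤ
canonMS = sort

MSTuple : ℕ → Set
MSTuple zero    = ⊤
MSTuple (suc n) = MSTuple n × MS (suc n)

lastMS : {n : ℕ} → MSTuple (suc n) → MS (suc n)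
lastMS = proj₂

canonTuple : {n : ℕ} → MSTuple n → List (List ℤ)
canonTuple {zero}  _       = []
canonTuple {suc n} (A , a) = canonTuple A ++ (canonMS (toList a) ∷ [])

ηrow : Array → List (List ℤ)
ηrow = map canonMS

_≟rows_ : (u v : List (List ℤ)) → Relation.Nullary.Dec (u ≡ v)
_≟rows_ = ≡-dec (≡-dec ℤ._≟_)

restrictRow : SSet Array → {n : ℕ} → MSTuple n → SSet Array
restrictRow S A = restrict _≟rows_ ηrow S (canonTuple A)

module Graph {V E : ℕ} (p q : Fin E → Fin V) where

  Joins : Fin E → Fin V → Fin V → Set
  Joins e u v = (p e ≡ u × q e ≡ v) ⊎ (p e ≡ v × q e ≡ u)

  data Walk : Fin V → Fin V → ℕ → Set where
    nil  : ∀ {u} → Walk u u 0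
    cons : ∀ {u w v d} (e : Fin E) → Joins e u w → Walk w v d → Walk u v (suc d)

  Connected : Set
  Connected = ∀ u v → ∃ λ d → Walk u v d

  Cycle : Set
  Cycle = Σ ℕ λ k → Σ (Fin (suc (suc k)) → Fin V) λ v → Σ (Fin (suc k) → Fin E) λ e →
            (v (Fin.fromℕ (suc k)) ≡ v zero) ×
            Injective _≡_ _≡_ (v ∘ inject₁) ×
            Injective _≡_ _≡_ e ×
            (∀ t → Joins (e t) (v (inject₁ t)) (v (suc t)))

  IsTree : Set
  IsTree = Connected × ¬ Cycle

  Dist : Fin V → Fin V → ℕ → Set
  Dist u v d = Walk u v d × (∀ d' → Walk u v d' → d ≤ d')

  Farther : Fin V → Fin E → Fin V → Set
  Farther root e x = Σ (Fin V) λ y →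
    ((p e ≡ x × q e ≡ y) ⊎ (q e ≡ x × p e ≡ y)) ×
    Σ ℕ λ dx → Σ ℕ λ dy → Dist root x dx × Dist root y dy × dy < dx

countFin : (n : ℕ) → (Fin n → Bool) → ℕ
countFin n P = length (filterᵇ P (allFin n))

permSign : {n : ℕ} → (Fin n → Fin n) → ℤ
permSign {n} r = -1ℤ ℤ.^ length
  (filterᵇ (λ ab → does (proj₁ ab Fin.<? proj₂ ab) ∧ does (r (proj₂ ab) Fin.<? r (proj₁ ab)))
     (concatMap (λ a → map (a ,_) (allFin n)) (allFin n)))

-- Level i = suc m of the parameters (graph G_i on Fin (i+1), i edges)
-- has sign s: G_i is a tree, r(0) = vertex 1 (index zero), r(j) the
-- endpoint of edge j farther from r(0), and
-- s = (-1)^#{j : p_{i,j} = r(j)} · sgn(r - 1).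
LevelSign : (m : ℕ) → (Fin (suc m) → Fin (suc (suc m))) →
            (Fin (suc m) → Fin (suc (suc m))) → ℤ → Set
LevelSign m p q s =
  IsTree × Σ (Fin (suc (suc m)) → Fin (suc (suc m))) λ r →
    (r zero ≡ zero) × (∀ j → Farther zero j (r (suc j))) ×
    (s ≡ (-1ℤ ℤ.^ countFin (suc m) (λ j → does (p j ≟ᶠ r (suc j)))) * permSign r)
  where open Graph p q

TreeSigns : (m : ℕ) → Params m → ℤ → Set
TreeSigns zero    _              s = s ≡ 1ℤ
TreeSigns (suc m) (ps , (p , q)) s =
  Σ ℤ λ s₁ → Σ ℤ λ s₂ → TreeSigns m ps s₁ × LevelSign m p q s₂ × (s ≡ s₁ * s₂)

SomeNonTree : (m : ℕ) → Params m → Set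
SomeNonTree zero    _              = ⊥
SomeNonTree (suc m) (ps , (p , q)) = SomeNonTree m ps ⊎ ¬ Graph.IsTree p q

data Sign : Set where
  sgn0 sgn+ sgn- : Sign

HasSign : (m : ℕ) → Params m → Sign → Set
HasSign m P sgn0 = SomeNonTree m P
HasSign m P sgn+ = TreeSigns m P 1ℤ
HasSign m P sgn- = TreeSigns m P -1ℤ

signedBy : Sign → SSet Array → SSet Array
signedBy sgn0 _ = emptyS
signedBy sgn+ S = S
signedBy sgn- S = oppS S

{-# OPTIONS --safe #-}

-- η_row is constant on both restricted sets, so a compatible sijection exists as soon as their signed sizes
-- agree. Counted row by row, the signed number of patterns with bottom row l and rows A is the signed box
-- sum, over the intervals [l (p j) , l (q j)) of the edges of the last graph, of the same count one row up;
-- these counts are alternating in the bottom row. For an alternating summand a box sum vanishes when two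
-- slots carry the same interval up to reversal, so an endpoint of a slot may slide along another edge.
-- Sliding edge ends off the last vertex until at most one edge reaches it, induction on the number of
-- vertices shows that every level is a fixed multiple of the Gelfand–Tsetlin level, non-zero only for a
-- connected graph, and a cycle makes it vanish. For a tree, orienting the edges away from the root,
-- sliding their starts to the root and reordering their ends identifies the multiple as
-- (-1)^#{j : p j = r (j + 1)} · sgn r.

module Submission where

open import Defs
open import Data.Nat as ℕ using (ℕ; zero; suc; _≤_; _<_)
import Data.Nat.Properties as ℕP
open import Algebra.Properties.CommutativeMonoid.Sum ℕP.+-0-commutativeMonoid
  using (sum; sum-syntax; sum-remove; ∑-distrib-+; sum-cong-≗; sum-replicate-zero)
open import Data.Bool using (Bool; true; false; not; _∧_; if_then_else_) renaming (T to IsTrue)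
import Data.Bool.Properties as BoolP
open import Data.Empty using (⊥-elim)
open import Data.Fin using (Fin; zero; suc; inject₁; fromℕ; punchIn; punchOut; toℕ; lower₁; splitAt; join; cast; _<?_)
import Data.Fin.Properties as FinP
open import Data.Fin.Permutation
  using (Permutation′; _⟨$⟩ʳ_; _⟨$⟩ˡ_; remove; inverseʳ; punchIn-permute; punchIn-permute′; permutation)
open import Data.Integer as ℤ using (ℤ; +_; -[1+_]; _+_; _*_; -_; _-_; 0ℤ; 1ℤ; -1ℤ)
import Data.Integer.Properties as ℤP
open import Data.Integer.Tactic.RingSolver using (solve-∀)
open import Data.List using (List; []; _∷_; _++_; map; concat; concatMap; upTo; length; filterᵇ; tabulate; allFin)
import Data.List.Properties as ListP
open import Data.List.Membership.Propositional.Properties using (∈-lookup)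
open import Data.List.Relation.Binary.Permutation.Propositional as Perm using (_↭_)
import Data.List.Relation.Binary.Pointwise as Pointwise
open import Data.List.Relation.Unary.All as All using (All)
open import Data.List.Relation.Unary.All.Properties using (all-filter)
import Data.List.Relation.Unary.Sorted.TotalOrder.Properties as SortedP
open import Data.List.Sort ℤP.≤-decTotalOrder using (sort; sort-↭; sort-↗)
open import Data.Product using (∃; _×_; _,_; proj₁; proj₂)
open import Data.Sum using (_⊎_; inj₁; inj₂)
open import Data.Unit using (⊤; tt)
open import Data.Vec as Vec using (Vec; []; _∷_; toList; lookup)
open import Data.Vec.Functional using (Vector; removeAt; updateAt) renaming (_∷_ to _∷ᶠ_)
import Data.Vec.Functional.Properties as VecFP
open import Function using (_∘_; _∘′_; id; const)
open import Function.Bundles using (mk⇔)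
open import Function.Definitions using (Injective)
open import Relation.Binary.Bundles using (DecTotalOrder)
open import Relation.Binary.PropositionalEquality hiding (J)
open import Relation.Nullary using (¬_; Dec; yes; no; does; contradiction)
open import Relation.Nullary.Decidable using (does-⇔)
import Relation.Nullary.Decidable as Dec

private
  variable
    X Y Z : Set
    n N V : ℕ

-- Signed sums over signed sets and intervals

listSum : List X → (X → ℤ) → ℤ
listSum []       f = 0ℤ
listSum (x ∷ xs) f = f x + listSum xs f

listSum-cong : (xs : List X) {f g : X → ℤ} → (∀ x → f x ≡ g x) → listSum xs f ≡ listSum xs g
listSum-cong []       f≗g = refl
listSum-cong (x ∷ xs) f≗g = cong₂ _+_ (f≗g x) (listSum-cong xs f≗g)

listSum-++ : (xs ys : List X) (f : X → ℤ) → listSum (xs ++ ys) f ≡ listSum xs f + listSum ys f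
listSum-++ []       ys f = sym (ℤP.+-identityˡ _)
listSum-++ (x ∷ xs) ys f = trans (cong (_+_ (f x)) (listSum-++ xs ys f)) (sym (ℤP.+-assoc (f x) _ _))

listSum-+ : (xs : List X) (f g : X → ℤ) → listSum xs (λ x → f x + g x) ≡ listSum xs f + listSum xs g
listSum-+ []       f g = refl
listSum-+ (x ∷ xs) f g = trans (cong (_+_ (f x + g x)) (listSum-+ xs f g)) (interchange (f x) (g x) (listSum xs f) (listSum xs g))
  where
  interchange : ∀ a b c d → a + b + (c + d) ≡ a + c + (b + d)
  interchange = solve-∀

listSum-* : (xs : List X) (c : ℤ) (f : X → ℤ) → listSum xs (λ x → c * f x) ≡ c * listSum xs f
listSum-* []       c f = sym (ℤP.*-zeroʳ c)
listSum-* (x ∷ xs) c f = trans (cong (_+_ (c * f x)) (listSum-* xs c f)) (sym (ℤP.*-distribˡ-+ c (f x) _))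

listSum-neg : (xs : List X) (f : X → ℤ) → listSum xs (λ x → - f x) ≡ - listSum xs f
listSum-neg []       f = refl
listSum-neg (x ∷ xs) f = trans (cong (_+_ (- f x)) (listSum-neg xs f)) (sym (ℤP.neg-distrib-+ (f x) _))

listSum-- : (xs : List X) (f g : X → ℤ) → listSum xs (λ x → f x - g x) ≡ listSum xs f - listSum xs g
listSum-- xs f g = trans (listSum-+ xs f (-_ ∘ g)) (cong (_+_ (listSum xs f)) (listSum-neg xs g))

listSum-zero : (xs : List X) → listSum xs (λ _ → 0ℤ) ≡ 0ℤ
listSum-zero []       = refl
listSum-zero (x ∷ xs) = trans (ℤP.+-identityˡ _) (listSum-zero xs)

listSum-comm : (xs : List X) (ys : List Y) (f : X → Y → ℤ) →
  listSum xs (λ x → listSum ys (f x)) ≡ listSum ys (λ y → listSum xs (λ x → f x y))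
listSum-comm []       ys f = sym (listSum-zero ys)
listSum-comm (x ∷ xs) ys f =
  trans (cong (_+_ (listSum ys (f x))) (listSum-comm xs ys f)) (sym (listSum-+ ys (f x) _))

listSum-map : (g : X → Y) (xs : List X) (f : Y → ℤ) → listSum (map g xs) f ≡ listSum xs (f ∘ g)
listSum-map g []       f = refl
listSum-map g (x ∷ xs) f = cong (_+_ (f (g x))) (listSum-map g xs f)

listSum-concatMap : (g : X → List Y) (xs : List X) (f : Y → ℤ) →
  listSum (concatMap g xs) f ≡ listSum xs (λ x → listSum (g x) f)
listSum-concatMap g []       f = refl
listSum-concatMap g (x ∷ xs) f =
  trans (listSum-++ (g x) (concatMap g xs) f) (cong (_+_ (listSum (g x) f)) (listSum-concatMap g xs f))

signedSum : SSet X → (X → ℤ) → ℤ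
signedSum (P , N) f = listSum P f - listSum N f

signedSum-cong : (S : SSet X) {f g : X → ℤ} → (∀ x → f x ≡ g x) → signedSum S f ≡ signedSum S g
signedSum-cong (P , N) f≗g = cong₂ _-_ (listSum-cong P f≗g) (listSum-cong N f≗g)

signedSum-+ : (S : SSet X) (f g : X → ℤ) → signedSum S (λ x → f x + g x) ≡ signedSum S f + signedSum S g
signedSum-+ (P , N) f g =
  trans (cong₂ _-_ (listSum-+ P f g) (listSum-+ N f g)) (interchange (listSum P f) (listSum P g) (listSum N f) (listSum N g))
  where
  interchange : ∀ a b c d → a + b - (c + d) ≡ a - c + (b - d)
  interchange = solve-∀

signedSum-* : (S : SSet X) (c : ℤ) (f : X → ℤ) → signedSum S (λ x → c * f x) ≡ c * signedSum S f
signedSum-* (P , N) c f =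
  trans (cong₂ _-_ (listSum-* P c f) (listSum-* N c f)) (factor c (listSum P f) (listSum N f))
  where
  factor : ∀ c a b → c * a - c * b ≡ c * (a - b)
  factor = solve-∀

signedSum-neg : (S : SSet X) (f : X → ℤ) → signedSum S (λ x → - f x) ≡ - signedSum S f
signedSum-neg (P , N) f =
  trans (cong₂ _-_ (listSum-neg P f) (listSum-neg N f)) (sym (ℤP.neg-distrib-+ (listSum P f) (- listSum N f)))

signedSum-comm : (S : SSet X) (T : SSet Y) (f : X → Y → ℤ) →
  signedSum S (λ x → signedSum T (f x)) ≡ signedSum T (λ y → signedSum S (λ x → f x y))
signedSum-comm {X = X} {Y = Y} (SP , SN) (TP , TN) f =
  begin
    listSum SP (λ x → listSum TP (f x) - listSum TN (f x)) - listSum SN (λ x → listSum TP (f x) - listSum TN (f x))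
  ≡⟨ cong₂ _-_ (trans (listSum-- SP _ _) (cong₂ _-_ (listSum-comm SP TP f) (listSum-comm SP TN f)))
               (trans (listSum-- SN _ _) (cong₂ _-_ (listSum-comm SN TP f) (listSum-comm SN TN f))) ⟩
    (Σ SP TP - Σ SP TN) - (Σ SN TP - Σ SN TN)
  ≡⟨ exchange (Σ SP TP) (Σ SP TN) (Σ SN TP) (Σ SN TN) ⟩
    (Σ SP TP - Σ SN TP) - (Σ SP TN - Σ SN TN)
  ≡⟨ sym (cong₂ _-_ (listSum-- TP _ _) (listSum-- TN _ _)) ⟩
    listSum TP (λ y → listSum SP (λ x → f x y) - listSum SN (λ x → f x y))
      - listSum TN (λ y → listSum SP (λ x → f x y) - listSum SN (λ x → f x y))
  ∎
  where
  open ≡-Reasoning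
  Σ : List X → List Y → ℤ
  Σ xs ys = listSum ys (λ y → listSum xs (λ x → f x y))
  exchange : ∀ a b c d → (a - b) - (c - d) ≡ (a - c) - (b - d)
  exchange = solve-∀

signedSum-mapS : (g : X → Y) (S : SSet X) (f : Y → ℤ) → signedSum (mapS g S) f ≡ signedSum S (f ∘ g)
signedSum-mapS g (P , N) f = cong₂ _-_ (listSum-map g P f) (listSum-map g N f)

signedSum-⨆ : (T : SSet X) (S : X → SSet Y) (f : Y → ℤ) →
  signedSum (⨆ T S) f ≡ signedSum T (λ t → signedSum (S t) f)
signedSum-⨆ {X = X} {Y = Y} (TP , TN) S f =
  begin
    listSum (concatMap (_⁺ ∘ S) TP ++ concatMap (_⁻ ∘ S) TN) f
      - listSum (concatMap (_⁻ ∘ S) TP ++ concatMap (_⁺ ∘ S) TN) f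
  ≡⟨ cong₂ _-_ (split (_⁺ ∘ S) (_⁻ ∘ S)) (split (_⁻ ∘ S) (_⁺ ∘ S)) ⟩
    (Σ _⁺ TP + Σ _⁻ TN) - (Σ _⁻ TP + Σ _⁺ TN)
  ≡⟨ regroup (Σ _⁺ TP) (Σ _⁻ TN) (Σ _⁻ TP) (Σ _⁺ TN) ⟩
    (Σ _⁺ TP - Σ _⁻ TP) - (Σ _⁺ TN - Σ _⁻ TN)
  ≡⟨ sym (cong₂ _-_ (listSum-- TP _ _) (listSum-- TN _ _)) ⟩
    signedSum (TP , TN) (λ t → signedSum (S t) f)
  ∎
  where
  open ≡-Reasoning
  Σ : (SSet Y → List Y) → List X → ℤ
  Σ side ts = listSum ts (λ t → listSum (side (S t)) f)
  split : (g h : X → List Y) →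
    listSum (concatMap g TP ++ concatMap h TN) f ≡ listSum TP (λ t → listSum (g t) f) + listSum TN (λ t → listSum (h t) f)
  split g h = trans (listSum-++ (concatMap g TP) _ f) (cong₂ _+_ (listSum-concatMap g TP f) (listSum-concatMap h TN f))
  regroup : ∀ a b c d → (a + b) - (c + d) ≡ (a - c) - (d - b)
  regroup = solve-∀

signedSum-prodWith : (g : X → Y → Z) (S : SSet X) (T : SSet Y) (f : Z → ℤ) →
  signedSum (prodWith g S T) f ≡ signedSum S (λ x → signedSum T (λ y → f (g x y)))
signedSum-prodWith {X = X} g (SP , SN) (TP , TN) f =
  begin
    listSum (pairs SP TP ++ pairs SN TN) f - listSum (pairs SP TN ++ pairs SN TP) f
  ≡⟨ cong₂ _-_ (split SP TP SN TN) (split SP TN SN TP) ⟩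
    (Σ SP TP + Σ SN TN) - (Σ SP TN + Σ SN TP)
  ≡⟨ regroup (Σ SP TP) (Σ SN TN) (Σ SP TN) (Σ SN TP) ⟩
    (Σ SP TP - Σ SP TN) - (Σ SN TP - Σ SN TN)
  ≡⟨ sym (cong₂ _-_ (listSum-- SP _ _) (listSum-- SN _ _)) ⟩
    signedSum (SP , SN) (λ x → signedSum (TP , TN) (λ y → f (g x y)))
  ∎
  where
  open ≡-Reasoning
  pairs : List X → List _ → List _
  pairs xs ys = concatMap (λ x → map (g x) ys) xs
  Σ : List X → List _ → ℤ
  Σ xs ys = listSum xs (λ x → listSum ys (λ y → f (g x y)))
  pairsSum : ∀ xs ys → listSum (pairs xs ys) f ≡ Σ xs ys
  pairsSum xs ys = trans (listSum-concatMap _ xs f) (listSum-cong xs (λ x → listSum-map (g x) ys f))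
  split : ∀ xs ys xs′ ys′ → listSum (pairs xs ys ++ pairs xs′ ys′) f ≡ Σ xs ys + Σ xs′ ys′
  split xs ys xs′ ys′ = trans (listSum-++ (pairs xs ys) _ f) (cong₂ _+_ (pairsSum xs ys) (pairsSum xs′ ys′))
  regroup : ∀ a b c d → (a + b) - (c + d) ≡ (a - c) - (d - b)
  regroup = solve-∀

Interval : Set
Interval = ℤ × ℤ

reverse : Interval → Interval
reverse (a , b) = b , a

intervalSum : Interval → (ℤ → ℤ) → ℤ
intervalSum (a , b) = signedSum (interval a b)

intervalSum-cong : ∀ I {h g : ℤ → ℤ} → (∀ x → h x ≡ g x) → intervalSum I h ≡ intervalSum I g
intervalSum-cong (a , b) = signedSum-cong (interval a b)

intervalSum-+ : ∀ I (h g : ℤ → ℤ) → intervalSum I (λ x → h x + g x) ≡ intervalSum I h + intervalSum I g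
intervalSum-+ (a , b) = signedSum-+ (interval a b)

intervalSum-* : ∀ I c (h : ℤ → ℤ) → intervalSum I (λ x → c * h x) ≡ c * intervalSum I h
intervalSum-* (a , b) = signedSum-* (interval a b)

intervalSum-neg : ∀ I (h : ℤ → ℤ) → intervalSum I (λ x → - h x) ≡ - intervalSum I h
intervalSum-neg (a , b) = signedSum-neg (interval a b)

intervalSum-comm : ∀ I J (f : ℤ → ℤ → ℤ) →
  intervalSum I (λ x → intervalSum J (f x)) ≡ intervalSum J (λ y → intervalSum I (λ x → f x y))
intervalSum-comm (a , b) (c , d) = signedSum-comm (interval a b) (interval c d)

indefiniteSum : (ℤ → ℤ) → ℤ → ℤ
indefiniteSum h (+ zero)         = 0ℤ
indefiniteSum h (+ suc n)        = indefiniteSum h (+ n) + h (+ n)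
indefiniteSum h -[1+ zero ]      = - h -[1+ zero ]
indefiniteSum h -[1+ suc n ]     = indefiniteSum h -[1+ n ] - h -[1+ suc n ]

indefiniteSum-suc : ∀ h x → indefiniteSum h (x + 1ℤ) ≡ indefiniteSum h x + h x
indefiniteSum-suc h (+ n)          = cong (λ m → indefiniteSum h (+ m)) (ℕP.+-comm n 1)
indefiniteSum-suc h -[1+ zero ]    = sym (ℤP.+-inverseˡ (h -[1+ zero ]))
indefiniteSum-suc h -[1+ suc n ]   = cancel (indefiniteSum h -[1+ n ]) (h -[1+ suc n ])
  where
  cancel : ∀ a b → a ≡ a - b + b
  cancel = solve-∀

listSum-range : ∀ h a n → listSum (map (λ i → a + + i) (upTo n)) h ≡ indefiniteSum h (a + + n) - indefiniteSum h a
listSum-range h a zero =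
  trans (sym (ℤP.+-inverseʳ (indefiniteSum h a))) (cong (λ x → indefiniteSum h x - indefiniteSum h a) (sym (ℤP.+-identityʳ a)))
listSum-range h a (suc n) =
  begin
    listSum (map shift (upTo (suc n))) h
  ≡⟨ cong (λ is → listSum (map shift is) h) (sym (ListP.upTo-∷ʳ n)) ⟩
    listSum (map shift (upTo n ++ n ∷ [])) h
  ≡⟨ trans (cong (λ is → listSum is h) (ListP.map-++ shift (upTo n) (n ∷ []))) (listSum-++ (map shift (upTo n)) _ h) ⟩
    listSum (map shift (upTo n)) h + (h (shift n) + 0ℤ)
  ≡⟨ cong (_+ (h (shift n) + 0ℤ)) (listSum-range h a n) ⟩
    indefiniteSum h (shift n) - indefiniteSum h a + (h (shift n) + 0ℤ)
  ≡⟨ regroup (indefiniteSum h (shift n)) (indefiniteSum h a) (h (shift n)) ⟩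
    indefiniteSum h (shift n) + h (shift n) - indefiniteSum h a
  ≡⟨ cong (_- indefiniteSum h a) (sym (trans (cong (indefiniteSum h) (+-suc a (+ n))) (indefiniteSum-suc h (shift n)))) ⟩
    indefiniteSum h (a + + suc n) - indefiniteSum h a
  ∎
  where
  open ≡-Reasoning
  shift : ℕ → ℤ
  shift i = a + + i
  regroup : ∀ x y z → x - y + (z + 0ℤ) ≡ x + z - y
  regroup = solve-∀
  +-suc : ∀ a m → a + (1ℤ + m) ≡ a + m + 1ℤ
  +-suc = solve-∀

intervalSum-indefiniteSum : ∀ a b h → intervalSum (a , b) h ≡ indefiniteSum h b - indefiniteSum h a
intervalSum-indefiniteSum a b h with b - a in eq
... | + zero =
  sym (trans (cong (λ x → indefiniteSum h x - indefiniteSum h a) (ℤP.i-j≡0⇒i≡j b a eq)) (ℤP.+-inverseʳ (indefiniteSum h a)))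
... | + suc n =
  trans (ℤP.+-identityʳ _) (trans (listSum-range h a (suc n)) (cong (λ x → indefiniteSum h x - indefiniteSum h a) (sym b≡a+n)))
  where
  split : ∀ a b → b ≡ a + (b - a)
  split = solve-∀
  b≡a+n : b ≡ a + + suc n
  b≡a+n = trans (split a b) (cong (_+_ a) eq)
... | -[1+ n ] =
  trans (cong (_-_ 0ℤ) (listSum-range h b (suc n)))
        (trans (cong (λ x → 0ℤ - (indefiniteSum h x - indefiniteSum h b)) (sym a≡b+n)) (flip (indefiniteSum h a) (indefiniteSum h b)))
  where
  split : ∀ a b → a ≡ b - (b - a)
  split = solve-∀
  a≡b+n : a ≡ b + + suc n
  a≡b+n = trans (split a b) (cong (_-_ b) eq)
  flip : ∀ x y → 0ℤ - (x - y) ≡ y - x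
  flip = solve-∀

intervalSum-concat : ∀ a b c h → intervalSum (a , b) h + intervalSum (b , c) h ≡ intervalSum (a , c) h
intervalSum-concat a b c h
  rewrite intervalSum-indefiniteSum a b h | intervalSum-indefiniteSum b c h | intervalSum-indefiniteSum a c h =
  telescope (indefiniteSum h a) (indefiniteSum h b) (indefiniteSum h c)
  where
  telescope : ∀ x y z → y - x + (z - y) ≡ z - x
  telescope = solve-∀

intervalSum-reverse : ∀ I h → intervalSum (reverse I) h ≡ - intervalSum I h
intervalSum-reverse (a , b) h
  rewrite intervalSum-indefiniteSum a b h | intervalSum-indefiniteSum b a h = swap (indefiniteSum h a) (indefiniteSum h b)
  where
  swap : ∀ x y → x - y ≡ - (y - x)
  swap = solve-∀

i≡-i⇒i≡0 : ∀ i → i ≡ - i → i ≡ 0ℤ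
i≡-i⇒i≡0 (+ zero)  _  = refl
i≡-i⇒i≡0 (+ suc n) ()
i≡-i⇒i≡0 -[1+ n ]  ()

intervalSum²-antisym : ∀ I (Q : ℤ → ℤ → ℤ) → (∀ x y → Q x y ≡ - Q y x) →
  intervalSum I (λ x → intervalSum I (Q x)) ≡ 0ℤ
intervalSum²-antisym I Q antisym = i≡-i⇒i≡0 _ (begin
    intervalSum I (λ x → intervalSum I (Q x))
  ≡⟨ intervalSum-comm I I Q ⟩
    intervalSum I (λ y → intervalSum I (λ x → Q x y))
  ≡⟨ intervalSum-cong I (λ y → trans (intervalSum-cong I (λ x → antisym x y)) (intervalSum-neg I (Q y))) ⟩
    intervalSum I (λ y → - intervalSum I (Q y))
  ≡⟨ intervalSum-neg I _ ⟩
    - intervalSum I (λ x → intervalSum I (Q x))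
  ∎)
  where open ≡-Reasoning

-- Box sums of alternating functions

-1^_ : ℕ → ℤ
-1^ n = -1ℤ ℤ.^ n

-1^-+ : ∀ m n → -1^ (m ℕ.+ n) ≡ -1^ m * -1^ n
-1^-+ = ℤP.^-distribˡ-+-* -1ℤ

boxSum : (Fin N → Interval) → (Vec ℤ N → ℤ) → ℤ
boxSum {zero}  I H = H []
boxSum {suc N} I H = intervalSum (I zero) (λ x → boxSum (I ∘ suc) (λ v → H (x ∷ v)))

swapAt : {A : Set} → Fin N → Vec A (suc N) → Vec A (suc N)
swapAt zero    (x ∷ y ∷ v) = y ∷ x ∷ v
swapAt (suc i) (x ∷ v)     = x ∷ swapAt i v

Alternating : (Vec ℤ N → ℤ) → Set
Alternating {zero}  H = ⊤
Alternating {suc N} H = ∀ (i : Fin N) v → H (swapAt i v) ≡ - H v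

alternating-tail : {H : Vec ℤ (suc N) → ℤ} → Alternating H → ∀ x → Alternating (λ v → H (x ∷ v))
alternating-tail {zero}  _   x = tt
alternating-tail {suc N} alt x i v = alt (suc i) (x ∷ v)

_[_]≔_ : {A : Set} → Vector A N → Fin N → A → Vector A N
I [ j ]≔ v = updateAt I j (const v)

boxSum-congˡ : (I J : Fin N → Interval) (H : Vec ℤ N → ℤ) → (∀ j → I j ≡ J j) → boxSum I H ≡ boxSum J H
boxSum-congˡ {zero}  I J H I≗J = refl
boxSum-congˡ {suc N} I J H I≗J =
  trans (cong (λ K → intervalSum K (λ x → boxSum (I ∘ suc) (λ v → H (x ∷ v)))) (I≗J zero))
        (intervalSum-cong (J zero) (λ x → boxSum-congˡ (I ∘ suc) (J ∘ suc) (λ v → H (x ∷ v)) (I≗J ∘ suc)))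

boxSum-congʳ : (I : Fin N → Interval) {H G : Vec ℤ N → ℤ} → (∀ v → H v ≡ G v) → boxSum I H ≡ boxSum I G
boxSum-congʳ {zero}  I H≗G = H≗G []
boxSum-congʳ {suc N} I H≗G = intervalSum-cong (I zero) (λ x → boxSum-congʳ (I ∘ suc) (λ v → H≗G (x ∷ v)))

boxSum-* : (I : Fin N → Interval) (c : ℤ) (H : Vec ℤ N → ℤ) → boxSum I (λ v → c * H v) ≡ c * boxSum I H
boxSum-* {zero}  I c H = refl
boxSum-* {suc N} I c H =
  trans (intervalSum-cong (I zero) (λ x → boxSum-* (I ∘ suc) c _)) (intervalSum-* (I zero) c _)

boxSum-neg : (I : Fin N → Interval) (H : Vec ℤ N → ℤ) → boxSum I (λ v → - H v) ≡ - boxSum I H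
boxSum-neg {zero}  I H = refl
boxSum-neg {suc N} I H =
  trans (intervalSum-cong (I zero) (λ x → boxSum-neg (I ∘ suc) _)) (intervalSum-neg (I zero) _)

boxSum-zero : (I : Fin N → Interval) → boxSum I (λ _ → 0ℤ) ≡ 0ℤ
boxSum-zero I = trans (boxSum-* I 0ℤ (const 0ℤ)) (ℤP.*-zeroˡ (boxSum I (const 0ℤ)))

boxSum-concat : ∀ (j : Fin N) I (H : Vec ℤ N → ℤ) a b c →
  boxSum (I [ j ]≔ (a , b)) H + boxSum (I [ j ]≔ (b , c)) H ≡ boxSum (I [ j ]≔ (a , c)) H
boxSum-concat zero    I H a b c = intervalSum-concat a b c _
boxSum-concat (suc j) I H a b c =
  trans (sym (intervalSum-+ (I zero) _ _)) (intervalSum-cong (I zero) (λ x → boxSum-concat j (I ∘ suc) _ a b c))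

boxSum-reverse : ∀ (j : Fin N) I (H : Vec ℤ N → ℤ) → boxSum (updateAt I j reverse) H ≡ - boxSum I H
boxSum-reverse zero    I H = intervalSum-reverse (I zero) _
boxSum-reverse (suc j) I H =
  trans (intervalSum-cong (I zero) (λ x → boxSum-reverse j (I ∘ suc) _)) (intervalSum-neg (I zero) _)

boxSum-set : ∀ (j : Fin N) I (H : Vec ℤ N → ℤ) {v} → I j ≡ v → boxSum (I [ j ]≔ v) H ≡ boxSum I H
boxSum-set j I H Ij≡v = boxSum-congˡ _ I H (VecFP.updateAt-id-local j I (sym Ij≡v))

boxSum-emptySlot : ∀ (j : Fin N) I (H : Vec ℤ N → ℤ) a → I j ≡ (a , a) → boxSum I H ≡ 0ℤ
boxSum-emptySlot j I H a Ij≡aa =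
  trans (sym (boxSum-set j I H Ij≡aa)) (x+x≡x⇒x≡0 _ (boxSum-concat j I H a a a))
  where
  x+x≡x⇒x≡0 : ∀ x → x + x ≡ x → x ≡ 0ℤ
  x+x≡x⇒x≡0 x eq = trans (cancel x) (trans (cong (_- x) eq) (ℤP.+-inverseʳ x))
    where
    cancel : ∀ x → x ≡ x + x - x
    cancel = solve-∀

boxSum-swap₀₁ : ∀ (I : Fin (suc (suc N)) → Interval) H → Alternating H →
  boxSum (I (suc zero) ∷ᶠ I zero ∷ᶠ (λ t → I (suc (suc t)))) H ≡ - boxSum I H
boxSum-swap₀₁ {N} I H alt =
  begin
    intervalSum (I (suc zero)) (λ y → intervalSum (I zero) (λ x → Q y x))
  ≡⟨ intervalSum-cong (I (suc zero)) (λ y → intervalSum-cong (I zero) (λ x →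
       trans (boxSum-congʳ rest (λ v → alt zero (x ∷ y ∷ v))) (boxSum-neg rest (λ v → H (x ∷ y ∷ v))))) ⟩
    intervalSum (I (suc zero)) (λ y → intervalSum (I zero) (λ x → - Q x y))
  ≡⟨ trans (intervalSum-cong (I (suc zero)) (λ y → intervalSum-neg (I zero) _)) (intervalSum-neg (I (suc zero)) _) ⟩
    - intervalSum (I (suc zero)) (λ y → intervalSum (I zero) (λ x → Q x y))
  ≡⟨ cong -_ (sym (intervalSum-comm (I zero) (I (suc zero)) Q)) ⟩
    - intervalSum (I zero) (λ x → intervalSum (I (suc zero)) (Q x))
  ∎
  where
  open ≡-Reasoning
  rest : Fin N → Interval
  rest t = I (suc (suc t))
  Q : ℤ → ℤ → ℤ
  Q x y = boxSum rest (λ v → H (x ∷ y ∷ v))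

boxSum-moveToFront : ∀ (j : Fin (suc N)) I H → Alternating H →
  boxSum I H ≡ -1^ toℕ j * boxSum (I j ∷ᶠ removeAt I j) H
boxSum-moveToFront zero I H alt = sym (ℤP.*-identityˡ _)
boxSum-moveToFront {suc N} (suc j) I H alt =
  begin
    intervalSum (I zero) (λ x → boxSum (I ∘ suc) (λ v → H (x ∷ v)))
  ≡⟨ intervalSum-cong (I zero) (λ x → boxSum-moveToFront j (I ∘ suc) (λ v → H (x ∷ v)) (alternating-tail alt x)) ⟩
    intervalSum (I zero) (λ x → -1^ toℕ j * boxSum (I (suc j) ∷ᶠ removeAt (I ∘ suc) j) (λ v → H (x ∷ v)))
  ≡⟨ intervalSum-* (I zero) (-1^ toℕ j) (λ x → boxSum (I (suc j) ∷ᶠ removeAt (I ∘ suc) j) (λ v → H (x ∷ v))) ⟩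
    -1^ toℕ j * boxSum K H
  ≡⟨ cong (-1^ toℕ j *_) (trans (sym (ℤP.neg-involutive _)) (cong -_ (sym (boxSum-swap₀₁ K H alt)))) ⟩
    -1^ toℕ j * - boxSum (K (suc zero) ∷ᶠ K zero ∷ᶠ (λ t → K (suc (suc t)))) H
  ≡⟨ cong (λ z → -1^ toℕ j * - z) (boxSum-congˡ (K (suc zero) ∷ᶠ K zero ∷ᶠ (λ t → K (suc (suc t)))) (I (suc j) ∷ᶠ removeAt I (suc j)) H
                                      λ { zero → refl ; (suc zero) → refl ; (suc (suc t)) → refl }) ⟩
    -1^ toℕ j * - boxSum (I (suc j) ∷ᶠ removeAt I (suc j)) H
  ≡⟨ sign (-1^ toℕ j) _ ⟩
    -1^ toℕ (suc j) * boxSum (I (suc j) ∷ᶠ removeAt I (suc j)) H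
  ∎
  where
  open ≡-Reasoning
  K : Fin (suc (suc N)) → Interval
  K = I zero ∷ᶠ I (suc j) ∷ᶠ removeAt (I ∘ suc) j
  sign : ∀ a b → a * - b ≡ -1ℤ * a * b
  sign = solve-∀

boxSum-repeated : ∀ (I : Fin N → Interval) H → Alternating H → ∀ {j j′} → j ≢ j′ → I j ≡ I j′ → boxSum I H ≡ 0ℤ
boxSum-repeated {suc zero}    I H alt {zero} {zero} j≢j′ _ = ⊥-elim (j≢j′ refl)
boxSum-repeated {suc (suc N)} I H alt {j} {j′} j≢j′ Ij≡Ij′ =
  begin
    boxSum I H
  ≡⟨ boxSum-moveToFront j I H alt ⟩
    -1^ toℕ j * intervalSum (I j) (λ x → boxSum J (λ v → H (x ∷ v)))
  ≡⟨ cong (-1^ toℕ j *_) (intervalSum-cong (I j) (λ x → boxSum-moveToFront t J _ (alternating-tail alt x))) ⟩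
    -1^ toℕ j * intervalSum (I j) (λ x → -1^ toℕ t * intervalSum (J t) (Q x))
  ≡⟨ cong (-1^ toℕ j *_) (trans (intervalSum-* (I j) (-1^ toℕ t) (λ x → intervalSum (J t) (Q x)))
                                 (cong (-1^ toℕ t *_) vanish)) ⟩
    -1^ toℕ j * (-1^ toℕ t * 0ℤ)
  ≡⟨ trans (cong (-1^ toℕ j *_) (ℤP.*-zeroʳ (-1^ toℕ t))) (ℤP.*-zeroʳ (-1^ toℕ j)) ⟩
    0ℤ
  ∎
  where
  open ≡-Reasoning
  J : Fin (suc N) → Interval
  J = removeAt I j
  t : Fin (suc N)
  t = punchOut j≢j′
  Q : ℤ → ℤ → ℤ
  Q x y = boxSum (removeAt J t) (λ v → H (x ∷ y ∷ v))
  antisym : ∀ x y → Q x y ≡ - Q y x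
  antisym x y = trans (boxSum-congʳ (removeAt J t) (λ v → alt zero (y ∷ x ∷ v))) (boxSum-neg (removeAt J t) _)
  Jt≡Ij : J t ≡ I j
  Jt≡Ij = trans (cong I (FinP.punchIn-punchOut j≢j′)) (sym Ij≡Ij′)
  vanish : intervalSum (I j) (λ x → intervalSum (J t) (Q x)) ≡ 0ℤ
  vanish = subst (λ K → intervalSum (I j) (λ x → intervalSum K (Q x)) ≡ 0ℤ) (sym Jt≡Ij)
                 (intervalSum²-antisym (I j) Q antisym)

boxSum-repeatedReversed : ∀ (I : Fin N → Interval) H → Alternating H → ∀ {j j′} → j ≢ j′ →
  I j ≡ reverse (I j′) → boxSum I H ≡ 0ℤ
boxSum-repeatedReversed I H alt {j} {j′} j≢j′ Ij≡Ij′ =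
  begin
    boxSum I H
  ≡⟨ sym (ℤP.neg-involutive _) ⟩
    - - boxSum I H
  ≡⟨ cong -_ (sym (boxSum-reverse j I H)) ⟩
    - boxSum (updateAt I j reverse) H
  ≡⟨ cong -_ (boxSum-repeated (updateAt I j reverse) H alt j≢j′ slots) ⟩
    - 0ℤ
  ∎
  where
  open ≡-Reasoning
  slots : updateAt I j reverse j ≡ updateAt I j reverse j′
  slots = trans (VecFP.updateAt-updates j I) (trans (cong reverse Ij≡Ij′)
                (sym (VecFP.updateAt-minimal j′ j I (j≢j′ ∘ sym))))

-- Inversions

indicator : Bool → ℕ
indicator true  = 1
indicator false = 0

length-filterᵇ-tabulate : (P : X → Bool) (f : Fin n → X) →
  length (filterᵇ P (tabulate f)) ≡ ∑[ i < n ] indicator (P (f i))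
length-filterᵇ-tabulate {n = zero}  P f = refl
length-filterᵇ-tabulate {n = suc n} P f with P (f zero)
... | true  = cong suc (length-filterᵇ-tabulate P (f ∘ suc))
... | false = length-filterᵇ-tabulate P (f ∘ suc)

length-filterᵇ-concat-tabulate : (P : X → Bool) (f : Fin n → List X) →
  length (filterᵇ P (concat (tabulate f))) ≡ ∑[ i < n ] length (filterᵇ P (f i))
length-filterᵇ-concat-tabulate {n = zero}  P f = refl
length-filterᵇ-concat-tabulate {n = suc n} P f =
  trans (cong length (ListP.filter-++ _ (f zero) _))
        (trans (ListP.length-++ (filterᵇ P (f zero)))
               (cong (length (filterᵇ P (f zero)) ℕ.+_) (length-filterᵇ-concat-tabulate P (f ∘ suc))))

countFin-sum : ∀ n (P : Fin n → Bool) → countFin n P ≡ ∑[ i < n ] indicator (P i)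
countFin-sum n P = length-filterᵇ-tabulate P id

Inverted : (Fin n → Fin n) → Fin n → Fin n → Bool
Inverted f a b = does (a <? b) ∧ does (f b <? f a)

inversions : (Fin n → Fin n) → ℕ
inversions {n} f = ∑[ a < n ] ∑[ b < n ] indicator (Inverted f a b)

permSign-inversions : (f : Fin n → Fin n) → permSign f ≡ -1^ inversions f
permSign-inversions {n} f = cong (-1ℤ ℤ.^_) (begin
    length (filterᵇ P (concatMap (λ a → map (a ,_) (allFin n)) (allFin n)))
  ≡⟨ cong (λ xs → length (filterᵇ P (concat xs))) (ListP.map-tabulate id (λ a → map (a ,_) (allFin n))) ⟩
    length (filterᵇ P (concat (tabulate (λ a → map (a ,_) (allFin n)))))
  ≡⟨ length-filterᵇ-concat-tabulate P (λ a → map (a ,_) (allFin n)) ⟩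
    ∑[ a < n ] length (filterᵇ P (map (a ,_) (allFin n)))
  ≡⟨ sum-cong-≗ (λ a → trans (cong (length ∘ filterᵇ P) (ListP.map-tabulate id (a ,_))) (length-filterᵇ-tabulate P (a ,_))) ⟩
    inversions f
  ∎)
  where
  open ≡-Reasoning
  P : Fin n × Fin n → Bool
  P (a , b) = Inverted f a b

punchIn-<-iff : ∀ (i : Fin (suc n)) a b → does (punchIn i a <? punchIn i b) ≡ does (a <? b)
punchIn-<-iff i a b = does-⇔ (mk⇔ cancel mono) (punchIn i a <? punchIn i b) (a <? b)
  where
  cancel : toℕ (punchIn i a) ℕ.< toℕ (punchIn i b) → toℕ a ℕ.< toℕ b
  cancel lt = ℕP.≰⇒> (λ b≤a → ℕP.<⇒≱ lt (FinP.punchIn-mono-≤ i b a b≤a))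
  mono : toℕ a ℕ.< toℕ b → toℕ (punchIn i a) ℕ.< toℕ (punchIn i b)
  mono lt = ℕP.≰⇒> (λ ib≤ia → ℕP.<⇒≱ lt (FinP.punchIn-cancel-≤ i b a ib≤ia))

count-punchIn-below : ∀ (i : Fin (suc n)) → ∑[ a < n ] indicator (does (punchIn i a <? i)) ≡ toℕ i
count-punchIn-below {n} zero = sum-replicate-zero n
count-punchIn-below {suc n} (suc i) = cong suc (count-punchIn-below i)

-- Since π i = 0, the inversions involving i are exactly the toℕ i pairs (a , i) with a < i.
inversions-remove : ∀ (π : Permutation′ (suc n)) i → π ⟨$⟩ʳ i ≡ zero →
  inversions (π ⟨$⟩ʳ_) ≡ toℕ i ℕ.+ inversions (remove i π ⟨$⟩ʳ_)
inversions-remove {n} π i πi≡0 =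
  begin
    ∑[ a < suc n ] R a
  ≡⟨ sum-remove R ⟩
    R i ℕ.+ ∑[ a < n ] R (punchIn i a)
  ≡⟨ cong₂ ℕ._+_ Ri≡0 (sum-cong-≗ (λ a → sum-remove (λ b → indicator (Inverted πʳ (punchIn i a) b)))) ⟩
    ∑[ a < n ] (indicator (Inverted πʳ (punchIn i a) i) ℕ.+ ∑[ b < n ] indicator (Inverted πʳ (punchIn i a) (punchIn i b)))
  ≡⟨ ∑-distrib-+ (λ a → indicator (Inverted πʳ (punchIn i a) i))
                 (λ a → ∑[ b < n ] indicator (Inverted πʳ (punchIn i a) (punchIn i b))) ⟩
    ∑[ a < n ] indicator (Inverted πʳ (punchIn i a) i) ℕ.+ ∑[ a < n ] ∑[ b < n ] indicator (Inverted πʳ (punchIn i a) (punchIn i b))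
  ≡⟨ cong₂ ℕ._+_ (trans (sum-cong-≗ below) (count-punchIn-below i))
                 (sum-cong-≗ (λ a → sum-cong-≗ (λ b → cong indicator (restricted a b)))) ⟩
    toℕ i ℕ.+ inversions ρ
  ∎
  where
  open ≡-Reasoning
  πʳ : Fin (suc n) → Fin (suc n)
  πʳ = π ⟨$⟩ʳ_
  ρ : Fin n → Fin n
  ρ = remove i π ⟨$⟩ʳ_
  R : Fin (suc n) → ℕ
  R a = ∑[ b < suc n ] indicator (Inverted πʳ a b)
  π∘punchIn : ∀ t → πʳ (punchIn i t) ≡ suc (ρ t)
  π∘punchIn t = trans (punchIn-permute π i t) (cong (λ z → punchIn z (ρ t)) πi≡0)
  Ri≡0 : R i ≡ 0
  Ri≡0 = trans (sum-cong-≗ (λ b → trans (cong (λ z → indicator (does (i <? b) ∧ does (πʳ b <? z))) πi≡0)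
                                          (cong indicator (BoolP.∧-zeroʳ (does (i <? b))))))
               (sum-replicate-zero (suc n))
  below : ∀ a → indicator (Inverted πʳ (punchIn i a) i) ≡ indicator (does (punchIn i a <? i))
  below a = cong indicator (trans (cong₂ (λ u v → does (punchIn i a <? i) ∧ does (u <? v)) πi≡0 (π∘punchIn a))
                                  (BoolP.∧-identityʳ _))
  restricted : ∀ a b → Inverted πʳ (punchIn i a) (punchIn i b) ≡ Inverted ρ a b
  restricted a b = cong₂ _∧_ (punchIn-<-iff i a b) (cong₂ (λ u v → does (u <? v)) (π∘punchIn b) (π∘punchIn a))

boxSum-permute : ∀ (π : Permutation′ n) I H → Alternating H →
  boxSum (I ∘ (π ⟨$⟩ʳ_)) H ≡ -1^ inversions (π ⟨$⟩ʳ_) * boxSum I H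
boxSum-permute {zero}  π I H alt = sym (ℤP.*-identityˡ _)
boxSum-permute {suc n} π I H alt =
  begin
    boxSum (I ∘ πʳ) H
  ≡⟨ boxSum-moveToFront i (I ∘ πʳ) H alt ⟩
    -1^ toℕ i * boxSum (I (πʳ i) ∷ᶠ removeAt (I ∘ πʳ) i) H
  ≡⟨ cong (-1^ toℕ i *_) (boxSum-congˡ (I (πʳ i) ∷ᶠ removeAt (I ∘ πʳ) i) (I zero ∷ᶠ (I ∘ suc ∘ ρʳ)) H
       λ { zero → cong I (inverseʳ π) ; (suc t) → cong I (punchIn-permute′ π zero t) }) ⟩
    -1^ toℕ i * intervalSum (I zero) (λ x → boxSum (I ∘ suc ∘ ρʳ) (λ v → H (x ∷ v)))
  ≡⟨ cong (-1^ toℕ i *_) (intervalSum-cong (I zero) (λ x → boxSum-permute ρ (I ∘ suc) _ (alternating-tail alt x))) ⟩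
    -1^ toℕ i * intervalSum (I zero) (λ x → -1^ inversions ρʳ * boxSum (I ∘ suc) (λ v → H (x ∷ v)))
  ≡⟨ cong (-1^ toℕ i *_) (intervalSum-* (I zero) (-1^ inversions ρʳ) _) ⟩
    -1^ toℕ i * (-1^ inversions ρʳ * boxSum I H)
  ≡⟨ sym (trans (cong (_* boxSum I H) (trans (cong -1^_ (inversions-remove π i (inverseʳ π))) (-1^-+ (toℕ i) _)))
                (ℤP.*-assoc (-1^ toℕ i) _ _)) ⟩
    -1^ inversions πʳ * boxSum I H
  ∎
  where
  open ≡-Reasoning
  πʳ : Fin (suc n) → Fin (suc n)
  πʳ = π ⟨$⟩ʳ_
  i : Fin (suc n)
  i = π ⟨$⟩ˡ zero
  ρ : Permutation′ n
  ρ = remove i π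
  ρʳ : Fin n → Fin n
  ρʳ = ρ ⟨$⟩ʳ_

injective⇒surjective : (g : Fin n → Fin n) → Injective _≡_ _≡_ g → ∀ v → ∃ λ u → g u ≡ v
injective⇒surjective g g-inj v with FinP.any? (λ u → g u FinP.≟ v)
... | yes hit = hit
injective⇒surjective {suc n} g g-inj v | no ¬hit = contradiction (FinP.injective⇒≤ h-inj) ℕP.1+n≰n
  where
  g≢v : ∀ u → v ≢ g u
  g≢v u v≡gu = ¬hit (u , sym v≡gu)
  h : Fin (suc n) → Fin n
  h u = punchOut (g≢v u)
  h-inj : Injective _≡_ _≡_ h
  h-inj {a} {b} ha≡hb = g-inj (FinP.punchOut-injective (g≢v a) (g≢v b) ha≡hb)

surjective⇒permutation : (f : Fin n → Fin n) → (∀ v → ∃ λ u → f u ≡ v) → Permutation′ n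
surjective⇒permutation {n} f surj = permutation f g (proj₂ ∘ surj) g∘f≗id
  where
  g : Fin n → Fin n
  g v = proj₁ (surj v)
  g-inj : Injective _≡_ _≡_ g
  g-inj {u} {v} gu≡gv = trans (sym (proj₂ (surj u))) (trans (cong f gu≡gv) (proj₂ (surj v)))
  g∘f≗id : ∀ x → g (f x) ≡ x
  g∘f≗id x with injective⇒surjective g g-inj x
  ... | a , refl = cong g (proj₂ (surj a))

-- Walks, and box sums over the edges of a graph

module Walks {V E : ℕ} (p q : Fin E → Fin V) where
  open Graph p q

  joins-sym : ∀ {e u w} → Joins e u w → Joins e w u
  joins-sym (inj₁ (pu , qw)) = inj₂ (pu , qw)
  joins-sym (inj₂ (pw , qu)) = inj₁ (pw , qu)

  joins? : ∀ e u w → Dec (Joins e u w)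
  joins? e u w = ((p e FinP.≟ u) Dec.×-dec (q e FinP.≟ w)) Dec.⊎-dec ((p e FinP.≟ w) Dec.×-dec (q e FinP.≟ u))

  walk? : ∀ u v d → Dec (Walk u v d)
  walk? u v zero with u FinP.≟ v
  ... | yes refl = yes nil
  ... | no u≢v   = no λ { nil → u≢v refl }
  walk? u v (suc d) with FinP.any? (λ e → FinP.any? (λ w → joins? e u w Dec.×-dec walk? w v d))
  ... | yes (e , w , j , wk) = yes (cons e j wk)
  ... | no ∄step             = no λ { (cons e j wk) → ∄step (e , _ , j , wk) }

  _++ʷ_ : ∀ {u w v d₁ d₂} → Walk u w d₁ → Walk w v d₂ → Walk u v (d₁ ℕ.+ d₂)
  nil         ++ʷ w₂ = w₂
  cons e j w₁ ++ʷ w₂ = cons e j (w₁ ++ʷ w₂)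

  reverseʷ : ∀ {u v d} → Walk u v d → Walk v u d
  reverseʷ nil = nil
  reverseʷ {d = suc d} (cons e j w) = subst (Walk _ _) (ℕP.+-comm d 1) (reverseʷ w ++ʷ cons e (joins-sym j) nil)

  shortest : ∀ {u v L} → Walk u v L → ∃ λ d → Dist u v d
  shortest {u} {v} {L} w = search L 0 (λ d′ d′<0 _ → ℕP.n≮0 d′<0) (subst (Walk u v) (sym (ℕP.+-identityʳ L)) w)
    where
    search : ∀ k d → (∀ d′ → d′ < d → ¬ Walk u v d′) → Walk u v (k ℕ.+ d) → ∃ λ d → Dist u v d
    search k d none-shorter wk with walk? u v d
    ... | yes wd = d , wd , λ d′ wd′ → ℕP.≮⇒≥ (λ d′<d → none-shorter d′ d′<d wd′)
    search zero    d none-shorter wk | no ¬wd = ⊥-elim (¬wd wk)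
    search (suc k) d none-shorter wk | no ¬wd =
      search k (suc d) none-shorter′ (subst (Walk u v) (sym (ℕP.+-suc k d)) wk)
      where
      none-shorter′ : ∀ d′ → d′ < suc d → ¬ Walk u v d′
      none-shorter′ d′ d′<1+d with ℕP.m≤n⇒m<n∨m≡n (ℕ.s≤s⁻¹ d′<1+d)
      ... | inj₁ d′<d = none-shorter d′ d′<d
      ... | inj₂ refl = ¬wd

  dist-unique : ∀ {u v d₁ d₂} → Dist u v d₁ → Dist u v d₂ → d₁ ≡ d₂
  dist-unique (w₁ , min₁) (w₂ , min₂) = ℕP.≤-antisym (min₁ _ w₂) (min₂ _ w₁)

  connected-via : (h : Fin V) → (∀ u → ∃ λ d → Walk u h d) → Connected
  connected-via h reach u v with reach u | reach v
  ... | d₁ , w₁ | d₂ , w₂ = d₁ ℕ.+ d₂ , w₁ ++ʷ reverseʷ w₂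

  walkAlong : ∀ {m} (w : Fin (suc m) → Fin V) (f : Fin m → Fin E) →
    (∀ t → Joins (f t) (w (inject₁ t)) (w (suc t))) → Walk (w zero) (w (fromℕ m)) m
  walkAlong {zero}  w f joins = nil
  walkAlong {suc m} w f joins = cons (f zero) (joins zero) (walkAlong (w ∘ suc) (f ∘ suc) (joins ∘ suc))

open Walks

translate : ∀ {V₁ E₁ V₂ E₂} {p₁ q₁ : Fin E₁ → Fin V₁} {p₂ q₂ : Fin E₂ → Fin V₂} (f : Fin V₁ → Fin V₂) →
  (∀ e u w → Graph.Joins p₁ q₁ e u w → ∃ λ d → Graph.Walk p₂ q₂ (f u) (f w) d) →
  ∀ {u v d} → Graph.Walk p₁ q₁ u v d → ∃ λ d′ → Graph.Walk p₂ q₂ (f u) (f v) d′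
translate f edge Graph.nil = 0 , Graph.nil
translate {p₂ = p₂} {q₂} f edge (Graph.cons e j w) with edge e _ _ j | translate f edge w
... | d₁ , w₁ | d₂ , w₂ = d₁ ℕ.+ d₂ , _++ʷ_ p₂ q₂ w₁ w₂

edgeIntervals : (Fin V → ℤ) → (p q : Fin N → Fin V) → Fin N → Interval
edgeIntervals k p q j = k (p j) , k (q j)

gtIntervals : (Fin (suc N) → ℤ) → Fin N → Interval
gtIntervals k j = k (inject₁ j) , k (suc j)

edgeIntervals-setStart : ∀ (k : Fin V → ℤ) (p q : Fin N → Fin V) j v t →
  edgeIntervals k (p [ j ]≔ v) q t ≡ (edgeIntervals k p q [ j ]≔ (k v , k (q j))) t
edgeIntervals-setStart k p q j v t with t FinP.≟ j
... | yes refl = trans (cong (λ u → k u , k (q j)) (VecFP.updateAt-updates j p))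
                       (sym (VecFP.updateAt-updates j (edgeIntervals k p q)))
... | no t≢j   = trans (cong (λ u → k u , k (q t)) (VecFP.updateAt-minimal t j p t≢j))
                       (sym (VecFP.updateAt-minimal t j (edgeIntervals k p q) t≢j))

edgeIntervals-setEnd : ∀ (k : Fin V → ℤ) (p q : Fin N → Fin V) j v t →
  edgeIntervals k p (q [ j ]≔ v) t ≡ (edgeIntervals k p q [ j ]≔ (k (p j) , k v)) t
edgeIntervals-setEnd k p q j v t with t FinP.≟ j
... | yes refl = trans (cong (λ u → k (p j) , k u) (VecFP.updateAt-updates j q))
                       (sym (VecFP.updateAt-updates j (edgeIntervals k p q)))
... | no t≢j   = trans (cong (λ u → k (p t) , k u) (VecFP.updateAt-minimal t j q t≢j))
                       (sym (VecFP.updateAt-minimal t j (edgeIntervals k p q) t≢j))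

boxSum-duplicateEdge : ∀ (k : Fin V → ℤ) (p q : Fin N → Fin V) H → Alternating H → ∀ {j₀ e} → j₀ ≢ e →
  ∀ {u w} → Graph.Joins p q e u w → boxSum (edgeIntervals k p q [ j₀ ]≔ (k u , k w)) H ≡ 0ℤ
boxSum-duplicateEdge k p q H alt {j₀} {e} j₀≢e {u} {w} = vanish
  where
  I J : Fin _ → Interval
  I = edgeIntervals k p q
  J = I [ j₀ ]≔ (k u , k w)
  Jj₀ : J j₀ ≡ (k u , k w)
  Jj₀ = VecFP.updateAt-updates j₀ I
  Je : J e ≡ I e
  Je = VecFP.updateAt-minimal e j₀ I (j₀≢e ∘ sym)
  vanish : Graph.Joins p q e u w → boxSum J H ≡ 0ℤ
  vanish (inj₁ (pe≡u , qe≡w)) =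
    boxSum-repeated J H alt j₀≢e (trans Jj₀ (trans (cong₂ (λ x y → k x , k y) (sym pe≡u) (sym qe≡w)) (sym Je)))
  vanish (inj₂ (pe≡w , qe≡u)) =
    boxSum-repeatedReversed J H alt j₀≢e
      (trans Jj₀ (trans (cong₂ (λ x y → k x , k y) (sym qe≡u) (sym pe≡w)) (cong reverse (sym Je))))

boxSum-slideStart : ∀ (k : Fin V → ℤ) (p q : Fin N → Fin V) H → Alternating H → ∀ {j₀ j₁} → j₁ ≢ j₀ →
  ∀ {u w} → Graph.Joins p q j₀ u w → ∀ x →
  boxSum (edgeIntervals k p q [ j₁ ]≔ (k u , x)) H ≡ boxSum (edgeIntervals k p q [ j₁ ]≔ (k w , x)) H
boxSum-slideStart k p q H alt {j₀} {j₁} j₁≢j₀ {u} {w} joins x =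
  begin
    boxSum (E [ j₁ ]≔ (k u , x)) H
  ≡⟨ sym (boxSum-concat j₁ E H (k u) (k w) x) ⟩
    boxSum (E [ j₁ ]≔ (k u , k w)) H + boxSum (E [ j₁ ]≔ (k w , x)) H
  ≡⟨ cong (_+ boxSum (E [ j₁ ]≔ (k w , x)) H) (boxSum-duplicateEdge k p q H alt j₁≢j₀ joins) ⟩
    0ℤ + boxSum (E [ j₁ ]≔ (k w , x)) H
  ≡⟨ ℤP.+-identityˡ _ ⟩
    boxSum (E [ j₁ ]≔ (k w , x)) H
  ∎
  where
  open ≡-Reasoning
  E : Fin _ → Interval
  E = edgeIntervals k p q

boxSum-slideEnd : ∀ (k : Fin V → ℤ) (p q : Fin N → Fin V) H → Alternating H → ∀ {j₀ j₁} → j₁ ≢ j₀ →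
  ∀ {u w} → Graph.Joins p q j₀ u w → ∀ x →
  boxSum (edgeIntervals k p q [ j₁ ]≔ (x , k u)) H ≡ boxSum (edgeIntervals k p q [ j₁ ]≔ (x , k w)) H
boxSum-slideEnd k p q H alt {j₀} {j₁} j₁≢j₀ {u} {w} joins x =
  begin
    boxSum (E [ j₁ ]≔ (x , k u)) H
  ≡⟨ sym (boxSum-concat j₁ E H x (k w) (k u)) ⟩
    boxSum (E [ j₁ ]≔ (x , k w)) H + boxSum (E [ j₁ ]≔ (k w , k u)) H
  ≡⟨ cong (_+_ (boxSum (E [ j₁ ]≔ (x , k w)) H)) (boxSum-duplicateEdge k p q H alt j₁≢j₀ (joins-sym p q joins)) ⟩
    boxSum (E [ j₁ ]≔ (x , k w)) H + 0ℤ
  ≡⟨ ℤP.+-identityʳ _ ⟩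
    boxSum (E [ j₁ ]≔ (x , k w)) H
  ∎
  where
  open ≡-Reasoning
  E : Fin _ → Interval
  E = edgeIntervals k p q

boxSum-walkAvoiding : ∀ (k : Fin V → ℤ) (p q : Fin (suc N) → Fin V) H → Alternating H → ∀ j₀ {a b d} →
  Graph.Walk (removeAt p j₀) (removeAt q j₀) a b d → boxSum (edgeIntervals k p q [ j₀ ]≔ (k a , k b)) H ≡ 0ℤ
boxSum-walkAvoiding k p q H alt j₀ {a} Graph.nil =
  boxSum-emptySlot j₀ (edgeIntervals k p q [ j₀ ]≔ (k a , k a)) H (k a) (VecFP.updateAt-updates j₀ (edgeIntervals k p q))
boxSum-walkAvoiding k p q H alt j₀ {b = b} (Graph.cons e joins rest) =
  trans (boxSum-slideStart k p q H alt (FinP.punchInᵢ≢i j₀ e ∘ sym) joins (k b))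
        (boxSum-walkAvoiding k p q H alt j₀ rest)

boxSum-edgeOnCycle : ∀ (k : Fin V → ℤ) (p q : Fin (suc N) → Fin V) H → Alternating H → ∀ j₀ {d} →
  Graph.Walk (removeAt p j₀) (removeAt q j₀) (p j₀) (q j₀) d → boxSum (edgeIntervals k p q) H ≡ 0ℤ
boxSum-edgeOnCycle k p q H alt j₀ walk =
  trans (sym (boxSum-set j₀ (edgeIntervals k p q) H refl)) (boxSum-walkAvoiding k p q H alt j₀ walk)

boxSum-cycle : ∀ (k : Fin V → ℤ) (p q : Fin (suc N) → Fin V) H → Alternating H →
  Graph.Cycle p q → boxSum (edgeIntervals k p q) H ≡ 0ℤ
boxSum-cycle k p q H alt (m , v , e , closed , _ , e-inj , joins) =
  boxSum-edgeOnCycle k p q H alt (e zero) (closeUp (joins zero))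
  where
  open Graph (removeAt p (e zero)) (removeAt q (e zero)) using (Walk)
  e₀≢ : ∀ t → e zero ≢ e (suc t)
  e₀≢ t = (λ ()) ∘ e-inj
  detour : Walk (v (suc zero)) (v zero) m
  detour = subst (λ x → Walk (v (suc zero)) x m) closed
    (walkAlong _ _ (v ∘ suc) (λ t → punchOut (e₀≢ t))
      (λ t → subst (λ x → Graph.Joins p q x (v (inject₁ (suc t))) (v (suc (suc t))))
                   (sym (FinP.punchIn-punchOut (e₀≢ t))) (joins (suc t))))
  closeUp : Graph.Joins p q (e zero) (v zero) (v (suc zero)) → Walk (p (e zero)) (q (e zero)) m
  closeUp (inj₁ (p≡v₀ , q≡v₁)) = subst₂ (λ x y → Walk x y m) (sym p≡v₀) (sym q≡v₁) (reverseʷ _ _ detour)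
  closeUp (inj₂ (p≡v₁ , q≡v₀)) = subst₂ (λ x y → Walk x y m) (sym p≡v₁) (sym q≡v₀) detour

gtPath-walkToZero : ∀ {n} (u : Fin (suc n)) → ∃ λ d → Graph.Walk {suc n} inject₁ suc u zero d
gtPath-walkToZero zero = 0 , Graph.nil
gtPath-walkToZero {suc n} (suc u) with translate suc shift (proj₂ (gtPath-walkToZero u))
  where
  shift : ∀ e u w → Graph.Joins {suc n} inject₁ suc e u w → ∃ λ d → Graph.Walk {suc (suc n)} inject₁ suc (suc u) (suc w) d
  shift e u w (inj₁ (eq₁ , eq₂)) = 1 , Graph.cons (suc e) (inj₁ (cong suc eq₁ , cong suc eq₂)) Graph.nil
  shift e u w (inj₂ (eq₁ , eq₂)) = 1 , Graph.cons (suc e) (inj₂ (cong suc eq₁ , cong suc eq₂)) Graph.nil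
... | d , w = d ℕ.+ 1 , _++ʷ_ inject₁ suc w (Graph.cons zero (inj₂ (refl , refl)) Graph.nil)

-- The chord (a , b) closes a cycle with the Gelfand–Tsetlin path 0 — 1 — ⋯ — n.
boxSum-gtWithChord : ∀ {n} (k : Fin (suc n) → ℤ) H → Alternating H → ∀ (a b : Fin (suc n)) →
  boxSum ((k a , k b) ∷ᶠ gtIntervals k) H ≡ 0ℤ
boxSum-gtWithChord k H alt a b =
  trans (boxSum-congˡ ((k a , k b) ∷ᶠ gtIntervals k) (edgeIntervals k (a ∷ᶠ inject₁) (b ∷ᶠ suc)) H
                      λ { zero → refl ; (suc j) → refl })
        (boxSum-edgeOnCycle k (a ∷ᶠ inject₁) (b ∷ᶠ suc) H alt zero
          (proj₂ (connected-via inject₁ suc zero gtPath-walkToZero a b)))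

-1^-cancel : ∀ n x → -1^ n * (-1^ n * x) ≡ x
-1^-cancel zero    x = trans (ℤP.*-identityˡ _) (ℤP.*-identityˡ x)
-1^-cancel (suc n) x = trans (square (-1^ n) x) (-1^-cancel n x)
  where
  square : ∀ a x → -1ℤ * a * (-1ℤ * a * x) ≡ a * (a * x)
  square = solve-∀

punchIn-fromℕ : ∀ {n} (j : Fin n) → punchIn (fromℕ n) j ≡ inject₁ j
punchIn-fromℕ zero    = refl
punchIn-fromℕ (suc j) = cong suc (punchIn-fromℕ j)

-- Split [a , n + 1) at n: the part [a , n) is a chord of the path, and [n , n + 1) is the last Gelfand–Tsetlin slot.
boxSum-gtPendant : ∀ {n} (k : Fin (suc (suc n)) → ℤ) H → Alternating H → ∀ (a : Fin (suc n)) →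
  intervalSum (k (inject₁ a) , k (fromℕ (suc n))) (λ x → boxSum (gtIntervals (k ∘ inject₁)) (λ v → H (x ∷ v)))
    ≡ -1^ n * boxSum (gtIntervals k) H
boxSum-gtPendant {n} k H alt a =
  begin
    intervalSum (k (inject₁ a) , k T) F
  ≡⟨ sym (intervalSum-concat (k (inject₁ a)) (k L) (k T) F) ⟩
    intervalSum (k (inject₁ a) , k L) F + intervalSum (k L , k T) F
  ≡⟨ cong₂ _+_ (boxSum-gtWithChord (k ∘ inject₁) H alt a (fromℕ n)) lastSlot ⟩
    0ℤ + lastFirst
  ≡⟨ trans (ℤP.+-identityˡ lastFirst) (sym (-1^-cancel n lastFirst)) ⟩
    -1^ n * (-1^ n * lastFirst)
  ≡⟨ cong (-1^ n *_) (sym moved) ⟩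
    -1^ n * boxSum (gtIntervals k) H
  ∎
  where
  open ≡-Reasoning
  T L : Fin (suc (suc n))
  T = fromℕ (suc n)
  L = inject₁ (fromℕ n)
  F : ℤ → ℤ
  F x = boxSum (gtIntervals (k ∘ inject₁)) (λ v → H (x ∷ v))
  lastFirst : ℤ
  lastFirst = boxSum (gtIntervals k (fromℕ n) ∷ᶠ removeAt (gtIntervals k) (fromℕ n)) H
  lastSlot : intervalSum (k L , k T) F ≡ lastFirst
  lastSlot = intervalSum-cong (k L , k T) (λ x → boxSum-congˡ _ _ (λ v → H (x ∷ v))
               (λ t → cong (gtIntervals k) (sym (punchIn-fromℕ t))))
  moved : boxSum (gtIntervals k) H ≡ -1^ n * lastFirst
  moved = trans (boxSum-moveToFront (fromℕ n) (gtIntervals k) H alt) (cong (λ m → -1^ m * lastFirst) (FinP.toℕ-fromℕ n))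

-- Trees

boxSum-orient : ∀ (b : Fin N → Bool) (J : Fin N → Interval) H →
  boxSum (λ j → if b j then reverse (J j) else J j) H ≡ -1^ (∑[ j < N ] indicator (b j)) * boxSum J H
boxSum-orient {zero}  b J H = sym (ℤP.*-identityˡ _)
boxSum-orient {suc N} b J H =
  trans (intervalSum-cong (slot (b zero)) (λ x → boxSum-orient (b ∘ suc) (J ∘ suc) _))
        (trans (intervalSum-* (slot (b zero)) c F) (first (b zero)))
  where
  slot : Bool → Interval
  slot β = if β then reverse (J zero) else J zero
  c : ℤ
  c = -1^ (∑[ j < N ] indicator (b (suc j)))
  F : ℤ → ℤ
  F x = boxSum (J ∘ suc) (λ v → H (x ∷ v))
  first : ∀ β → c * intervalSum (slot β) F ≡ -1^ (indicator β ℕ.+ ∑[ j < N ] indicator (b (suc j))) * intervalSum (J zero) F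
  first false = refl
  first true  = trans (cong (c *_) (intervalSum-reverse (J zero) F)) (sign c (intervalSum (J zero) F))
    where
    sign : ∀ a b → a * - b ≡ -1ℤ * a * b
    sign = solve-∀

sum-<-atOnePoint : ∀ (f g : Fin N → ℕ) j → (∀ t → t ≢ j → f t ≡ g t) → f j < g j → sum f < sum g
sum-<-atOnePoint {suc N} f g j f≗g fj<gj =
  subst₂ _<_ (sym (sum-remove {i = j} f)) (sym (sum-remove {i = j} g))
    (subst (λ w → f j ℕ.+ w < g j ℕ.+ sum (removeAt g j))
           (sym (sum-cong-≗ (λ t → f≗g (punchIn j t) (FinP.punchInᵢ≢i j t))))
           (ℕP.+-monoˡ-< _ fj<gj))

-- Slot j runs from a j to x j, where a j is nearer to the root 0. A start a j ≠ 0 is the end x j′ of another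
-- slot, along which it slides to a j′; this lowers the total depth until every start is the root.
module Rerooting (k : Fin (suc N) → ℤ) (H : Vec ℤ N → ℤ) (alt : Alternating H)
                 (x : Fin N → Fin (suc N)) (hits : ∀ v → v ≢ zero → ∃ λ j → x j ≡ v)
                 (depth : Fin (suc N) → ℕ) where

  Descending : (Fin N → Fin (suc N)) → Set
  Descending a = ∀ j → depth (a j) < depth (x j)

  weight : (Fin N → Fin (suc N)) → ℕ
  weight a = ∑[ j < N ] depth (a j)

  reroot-step : ∀ a {j j′} → x j′ ≡ a j → j ≢ j′ →
    boxSum (edgeIntervals k a x) H ≡ boxSum (edgeIntervals k (a [ j ]≔ a j′) x) H
  reroot-step a {j} {j′} xj′≡aj j≢j′ =
    begin
      boxSum I H
    ≡⟨ sym (boxSum-set j I H refl) ⟩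
      boxSum (I [ j ]≔ (k (a j) , k (x j))) H
    ≡⟨ boxSum-slideStart k a x H alt j≢j′ (inj₂ (refl , xj′≡aj)) (k (x j)) ⟩
      boxSum (I [ j ]≔ (k (a j′) , k (x j))) H
    ≡⟨ boxSum-congˡ _ _ H (λ t → sym (edgeIntervals-setStart k a x j (a j′) t)) ⟩
      boxSum (edgeIntervals k (a [ j ]≔ a j′) x) H
    ∎
    where
    open ≡-Reasoning
    I : Fin N → Interval
    I = edgeIntervals k a x

  reroot : ∀ fuel a → weight a < fuel → Descending a →
    boxSum (edgeIntervals k a x) H ≡ boxSum (edgeIntervals k (const zero) x) H
  reroot (suc fuel) a weight<fuel desc with FinP.all? (λ j → a j FinP.≟ zero)
  ... | yes a≡0 = boxSum-congˡ _ _ H (λ j → cong (λ v → k v , k (x j)) (a≡0 j))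
  ... | no a≢0  = trans (reroot-step a xj′≡aj j≢j′) (reroot fuel a′ (ℕP.<-≤-trans lighter (ℕ.s≤s⁻¹ weight<fuel)) desc′)
    where
    j : Fin N
    j = proj₁ (FinP.¬∀⟶∃¬ N _ (λ j → a j FinP.≟ zero) a≢0)
    aj≢0 : a j ≢ zero
    aj≢0 = proj₂ (FinP.¬∀⟶∃¬ N _ (λ j → a j FinP.≟ zero) a≢0)
    j′ : Fin N
    j′ = proj₁ (hits (a j) aj≢0)
    xj′≡aj : x j′ ≡ a j
    xj′≡aj = proj₂ (hits (a j) aj≢0)
    a′ : Fin N → Fin (suc N)
    a′ = a [ j ]≔ a j′
    j≢j′ : j ≢ j′
    j≢j′ j≡j′ = ℕP.<-irrefl (cong depth (trans (sym xj′≡aj) (cong x (sym j≡j′)))) (desc j)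
    deeper : depth (a j′) < depth (a j)
    deeper = subst (λ v → depth (a j′) < depth v) xj′≡aj (desc j′)
    desc′ : Descending a′
    desc′ t with t FinP.≟ j
    ... | yes refl = subst (_< depth (x j)) (cong depth (sym (VecFP.updateAt-updates j a))) (ℕP.<-trans deeper (desc j))
    ... | no t≢j   = subst (_< depth (x t)) (cong depth (sym (VecFP.updateAt-minimal t j a t≢j))) (desc t)
    lighter : weight a′ < weight a
    lighter = sum-<-atOnePoint (depth ∘ a′) (depth ∘ a) j
      (λ t t≢j → cong depth (VecFP.updateAt-minimal t j a t≢j))
      (subst (_< depth (a j)) (cong depth (sym (VecFP.updateAt-updates j a))) deeper)

  boxSum-reroot : ∀ a → Descending a → boxSum (edgeIntervals k a x) H ≡ boxSum (edgeIntervals k (const zero) x) H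
  boxSum-reroot a = reroot (suc (weight a)) a ℕP.≤-refl

boxSum-gtReroot : ∀ (k : Fin (suc N) → ℤ) H → Alternating H →
  boxSum (gtIntervals k) H ≡ boxSum (λ j → k zero , k (suc j)) H
boxSum-gtReroot k H alt =
  Rerooting.boxSum-reroot k H alt suc successor toℕ inject₁ (λ j → ℕP.≤-reflexive (cong suc (FinP.toℕ-inject₁ j)))
  where
  successor : ∀ v → v ≢ zero → ∃ λ j → suc j ≡ v
  successor zero    v≢0 = contradiction refl v≢0
  successor (suc v) _   = v , refl

module TreeLevel (m : ℕ) (p q : Fin (suc m) → Fin (suc (suc m))) (s : ℤ) (level : LevelSign m p q s) where
  open Graph p q

  connected : Connected
  connected = proj₁ (proj₁ level)

  r : Fin (suc (suc m)) → Fin (suc (suc m))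
  r = proj₁ (proj₂ level)

  r0≡0 : r zero ≡ zero
  r0≡0 = proj₁ (proj₂ (proj₂ level))

  farther : ∀ j → Farther zero j (r (suc j))
  farther = proj₁ (proj₂ (proj₂ (proj₂ level)))

  s≡ : s ≡ -1^ countFin (suc m) (λ j → does (p j FinP.≟ r (suc j))) * permSign r
  s≡ = proj₂ (proj₂ (proj₂ (proj₂ level)))

  far near : Fin (suc m) → Fin (suc (suc m))
  far j  = r (suc j)
  near j = proj₁ (farther j)

  ends : ∀ j → (p j ≡ far j × q j ≡ near j) ⊎ (q j ≡ far j × p j ≡ near j)
  ends j = proj₁ (proj₂ (farther j))

  depth : Fin (suc (suc m)) → ℕ
  depth v = proj₁ (shortest p q (proj₂ (connected zero v)))

  depth-dist : ∀ v → Dist zero v (depth v)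
  depth-dist v = proj₂ (shortest p q (proj₂ (connected zero v)))

  near<far : ∀ j → depth (near j) < depth (far j)
  near<far j with proj₂ (proj₂ (farther j))
  ... | dx , dy , far-dist , near-dist , dy<dx =
    subst₂ _<_ (dist-unique p q near-dist (depth-dist (near j))) (dist-unique p q far-dist (depth-dist (far j))) dy<dx

  near≢far : ∀ j → near j ≢ far j
  near≢far j eq = ℕP.<-irrefl (cong depth eq) (near<far j)

  endpoints : ∀ e {v w} → Joins e v w → far e ≢ v → far e ≡ w × near e ≡ v
  endpoints e joins far≢v with ends e | joins
  ... | inj₁ (p≡far , _)     | inj₁ (p≡v , _)   = contradiction (trans (sym p≡far) p≡v) far≢v
  ... | inj₁ (p≡far , q≡near) | inj₂ (p≡w , q≡v) = trans (sym p≡far) p≡w , trans (sym q≡near) q≡v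
  ... | inj₂ (q≡far , p≡near) | inj₁ (p≡v , q≡w) = trans (sym q≡far) q≡w , trans (sym p≡near) p≡v
  ... | inj₂ (q≡far , _)     | inj₂ (_ , q≡v)   = contradiction (trans (sym q≡far) q≡v) far≢v

  -- The last edge of a shortest walk from the root to v has v as its farther endpoint.
  far-onto : ∀ v → v ≢ zero → ∃ λ j → far j ≡ v
  far-onto v = last v (depth v) (depth-dist v)
    where
    last : ∀ v d → Dist zero v d → v ≢ zero → ∃ λ j → far j ≡ v
    last v zero    (nil , _) v≢0 = contradiction refl v≢0
    last v (suc d) (walk , minimal) _ with reverseʷ p q walk
    ... | cons e joins rest with far e FinP.≟ v
    ...   | yes far≡v = e , far≡v
    ...   | no far≢v  = contradiction (ℕP.m≤n⇒m≤1+n far-depth) (ℕP.<⇒≱ (subst (_< depth (far e)) near-depth (near<far e)))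
      where
      near-depth : depth (near e) ≡ suc d
      near-depth = dist-unique p q (depth-dist (near e))
        (subst (λ u → Dist zero u (suc d)) (sym (proj₂ (endpoints e joins far≢v))) (walk , minimal))
      far-depth : depth (far e) ≤ d
      far-depth = proj₂ (depth-dist (far e)) d
        (subst (λ u → Walk zero u d) (sym (proj₁ (endpoints e joins far≢v))) (reverseʷ p q rest))

  ρ : Permutation′ (suc (suc m))
  ρ = surjective⇒permutation r onto
    where
    onto : ∀ v → ∃ λ u → r u ≡ v
    onto v with v FinP.≟ zero
    ... | yes refl = zero , r0≡0
    ... | no v≢0   = suc (proj₁ (far-onto v v≢0)) , proj₂ (far-onto v v≢0)

  π : Fin (suc m) → Fin (suc m)
  π = remove zero ρ ⟨$⟩ʳ_

  far≡suc∘π : ∀ t → far t ≡ suc (π t)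
  far≡suc∘π t = trans (punchIn-permute ρ zero t) (cong (λ z → punchIn z (π t)) r0≡0)

  permSign-r : permSign r ≡ -1^ inversions π
  permSign-r = trans (permSign-inversions r) (cong -1^_ (inversions-remove ρ zero r0≡0))

  flipped : Fin (suc m) → Bool
  flipped j = does (p j FinP.≟ far j)

  oriented : ∀ (k : Fin (suc (suc m)) → ℤ) j →
    edgeIntervals k p q j ≡ (if flipped j then reverse (k (near j) , k (far j)) else (k (near j) , k (far j)))
  oriented k j with p j FinP.≟ far j | ends j
  ... | yes _      | inj₁ (p≡far , q≡near) = cong₂ (λ u v → k u , k v) p≡far q≡near
  ... | yes p≡far  | inj₂ (_ , p≡near)     = contradiction (trans (sym p≡near) p≡far) (near≢far j)
  ... | no p≢far   | inj₁ (p≡far , _)      = contradiction p≡far p≢far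
  ... | no _       | inj₂ (q≡far , p≡near) = cong₂ (λ u v → k u , k v) p≡near q≡far

  boxSum-treeLevel : ∀ H → Alternating H → ∀ (k : Fin (suc (suc m)) → ℤ) →
    boxSum (edgeIntervals k p q) H ≡ s * boxSum (gtIntervals k) H
  boxSum-treeLevel H alt k =
    begin
      boxSum (edgeIntervals k p q) H
    ≡⟨ boxSum-congˡ _ _ H (oriented k) ⟩
      boxSum (λ j → if flipped j then reverse (k (near j) , k (far j)) else (k (near j) , k (far j))) H
    ≡⟨ boxSum-orient flipped (edgeIntervals k near far) H ⟩
      ε * boxSum (edgeIntervals k near far) H
    ≡⟨ cong (ε *_) (Rerooting.boxSum-reroot k H alt far far-onto depth near near<far) ⟩
      ε * boxSum (edgeIntervals k (const zero) far) H
    ≡⟨ cong (ε *_) (boxSum-congˡ _ (star ∘ π) H (λ j → cong (λ v → k zero , k v) (far≡suc∘π j))) ⟩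
      ε * boxSum (star ∘ π) H
    ≡⟨ cong (ε *_) (boxSum-permute (remove zero ρ) star H alt) ⟩
      ε * (-1^ inversions π * boxSum star H)
    ≡⟨ cong (λ z → ε * (-1^ inversions π * z)) (sym (boxSum-gtReroot k H alt)) ⟩
      ε * (-1^ inversions π * boxSum (gtIntervals k) H)
    ≡⟨ sym (ℤP.*-assoc ε _ _) ⟩
      ε * -1^ inversions π * boxSum (gtIntervals k) H
    ≡⟨ cong (_* boxSum (gtIntervals k) H) (sym (trans s≡ (cong₂ (λ c σ → -1^ c * σ) (countFin-sum (suc m) flipped) permSign-r))) ⟩
      s * boxSum (gtIntervals k) H
    ∎
    where
    open ≡-Reasoning
    ε : ℤ
    ε = -1^ (∑[ j < suc m ] indicator (flipped j))
    star : Fin (suc m) → Interval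
    star j = k zero , k (suc j)

-- Every level is a multiple of the Gelfand–Tsetlin level

record Reduction {N : ℕ} (p q : Fin N → Fin (suc N)) : Set where
  field
    coeff     : ℤ
    reduces   : ∀ H → Alternating H → ∀ k → boxSum (edgeIntervals k p q) H ≡ coeff * boxSum (gtIntervals k) H
    connected : coeff ≢ 0ℤ → Graph.Connected p q

module _ {N : ℕ} {p q : Fin N → Fin (suc N)} where

  vanishing : (∀ H → Alternating H → ∀ k → boxSum (edgeIntervals k p q) H ≡ 0ℤ) → Reduction p q
  vanishing ≡0 = record
    { coeff     = 0ℤ
    ; reduces   = λ H alt k → trans (≡0 H alt k) (sym (ℤP.*-zeroˡ (boxSum (gtIntervals k) H)))
    ; connected = λ 0≢0 → contradiction refl 0≢0
    }

  loop-vanishing : ∀ {j} → p j ≡ q j → Reduction p q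
  loop-vanishing {j} pj≡qj = vanishing λ H alt k →
    boxSum-emptySlot j (edgeIntervals k p q) H (k (p j)) (cong (λ v → k (p j) , k v) (sym pj≡qj))

  transfer : ∀ {p′ q′ : Fin N → Fin (suc N)} (c : ℤ) → Reduction p′ q′ →
    (∀ H → Alternating H → ∀ k → boxSum (edgeIntervals k p q) H ≡ c * boxSum (edgeIntervals k p′ q′) H) →
    (∀ e u w → Graph.Joins p′ q′ e u w → ∃ λ d → Graph.Walk p q u w d) → Reduction p q
  transfer {p′} {q′} c R′ scale simulate = record
    { coeff     = c * coeff
    ; reduces   = λ H alt k → trans (scale H alt k) (trans (cong (c *_) (reduces H alt k)) (sym (ℤP.*-assoc c coeff _)))
    ; connected = λ c*coeff≢0 u v → translate id simulate (proj₂ (connected (c*coeff≢0 ∘ zero-factor) u v))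
    }
    where
    open Reduction R′
    zero-factor : coeff ≡ 0ℤ → c * coeff ≡ 0ℤ
    zero-factor coeff≡0 = trans (cong (c *_) coeff≡0) (ℤP.*-zeroʳ c)

reduction-zero : (p q : Fin 0 → Fin 1) → Reduction p q
reduction-zero p q = record
  { coeff     = 1ℤ
  ; reduces   = λ H alt k → sym (ℤP.*-identityˡ (H []))
  ; connected = λ _ → λ { zero zero → 0 , Graph.nil }
  }

module ReductionStep (n : ℕ) (IH : (p q : Fin n → Fin (suc n)) → Reduction p q) where

  Edges : Set
  Edges = Fin (suc n) → Fin (suc (suc n))

  T : Fin (suc (suc n))
  T = fromℕ (suc n)

  lower : ∀ v → v ≢ T → Fin (suc n)
  lower v v≢T = lower₁ v (λ n+1≡v → v≢T (FinP.toℕ-injective (trans (sym n+1≡v) (sym (FinP.toℕ-fromℕ (suc n))))))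

  inject₁-lower : ∀ v (v≢T : v ≢ T) → inject₁ (lower v v≢T) ≡ v
  inject₁-lower v v≢T = FinP.inject₁-lower₁ v _

  module Lowered (p q : Edges) (j₀ : Fin (suc n))
                 (p≢T : ∀ t → p (punchIn j₀ t) ≢ T) (q≢T : ∀ t → q (punchIn j₀ t) ≢ T) where

    p₀ q₀ : Fin n → Fin (suc n)
    p₀ t = lower (p (punchIn j₀ t)) (p≢T t)
    q₀ t = lower (q (punchIn j₀ t)) (q≢T t)

    open Reduction (IH p₀ q₀) public renaming (coeff to c₀; reduces to reduces₀; connected to connected₀)

    boxSum-lowered : ∀ H → Alternating H → ∀ k → boxSum (edgeIntervals k p q) H ≡
      -1^ toℕ j₀ * (c₀ * intervalSum (edgeIntervals k p q j₀) (λ x → boxSum (gtIntervals (k ∘ inject₁)) (λ v → H (x ∷ v))))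
    boxSum-lowered H alt k =
      begin
        boxSum E H
      ≡⟨ boxSum-moveToFront j₀ E H alt ⟩
        -1^ toℕ j₀ * intervalSum (E j₀) (λ x → boxSum (removeAt E j₀) (λ v → H (x ∷ v)))
      ≡⟨ cong (-1^ toℕ j₀ *_) (intervalSum-cong (E j₀) (λ x →
           trans (boxSum-congˡ _ _ _ lowered) (reduces₀ _ (alternating-tail alt x) (k ∘ inject₁)))) ⟩
        -1^ toℕ j₀ * intervalSum (E j₀) (λ x → c₀ * boxSum (gtIntervals (k ∘ inject₁)) (λ v → H (x ∷ v)))
      ≡⟨ cong (-1^ toℕ j₀ *_) (intervalSum-* (E j₀) c₀ (λ x → boxSum (gtIntervals (k ∘ inject₁)) (λ v → H (x ∷ v)))) ⟩
        -1^ toℕ j₀ * (c₀ * intervalSum (E j₀) (λ x → boxSum (gtIntervals (k ∘ inject₁)) (λ v → H (x ∷ v))))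
      ∎
      where
      open ≡-Reasoning
      E : Fin (suc n) → Interval
      E = edgeIntervals k p q
      lowered : ∀ t → removeAt E j₀ t ≡ edgeIntervals (k ∘ inject₁) p₀ q₀ t
      lowered t = sym (cong₂ (λ u w → k u , k w) (inject₁-lower _ (p≢T t)) (inject₁-lower _ (q≢T t)))

    lift : ∀ {u w d} → Graph.Walk p₀ q₀ u w d → ∃ λ d′ → Graph.Walk p q (inject₁ u) (inject₁ w) d′
    lift = translate inject₁ edge
      where
      raise : ∀ {f : Edges} (f≢T : ∀ t → f (punchIn j₀ t) ≢ T) {e x} →
        lower (f (punchIn j₀ e)) (f≢T e) ≡ x → f (punchIn j₀ e) ≡ inject₁ x
      raise f≢T {e} eq = trans (sym (inject₁-lower _ (f≢T e))) (cong inject₁ eq)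
      edge : ∀ e u w → Graph.Joins p₀ q₀ e u w → ∃ λ d → Graph.Walk p q (inject₁ u) (inject₁ w) d
      edge e u w (inj₁ (p≡u , q≡w)) = 1 , Graph.cons (punchIn j₀ e) (inj₁ (raise {p} p≢T p≡u , raise {q} q≢T q≡w)) Graph.nil
      edge e u w (inj₂ (p≡w , q≡u)) = 1 , Graph.cons (punchIn j₀ e) (inj₂ (raise {p} p≢T p≡w , raise {q} q≢T q≡u)) Graph.nil

  reduction-untouched : ∀ p q → (∀ j → p j ≢ T) → (∀ j → q j ≢ T) → Reduction p q
  reduction-untouched p q p≢T q≢T = vanishing λ H alt k →
    begin
      boxSum (edgeIntervals k p q) H
    ≡⟨ boxSum-lowered H alt k ⟩
      1ℤ * (c₀ * intervalSum (k (p zero) , k (q zero)) (F H k))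
    ≡⟨ cong (λ z → 1ℤ * (c₀ * z))
         (trans (cong₂ (λ u w → intervalSum (k u , k w) (F H k)) (sym (inject₁-lower _ (p≢T zero))) (sym (inject₁-lower _ (q≢T zero))))
                (boxSum-gtWithChord (k ∘ inject₁) H alt (lower _ (p≢T zero)) (lower _ (q≢T zero)))) ⟩
      1ℤ * (c₀ * 0ℤ)
    ≡⟨ trans (ℤP.*-identityˡ _) (ℤP.*-zeroʳ c₀) ⟩
      0ℤ
    ∎
    where
    open ≡-Reasoning
    open Lowered p q zero (p≢T ∘ suc) (q≢T ∘ suc)
    F : ∀ H k → ℤ → ℤ
    F H k x = boxSum (gtIntervals (k ∘ inject₁)) (λ v → H (x ∷ v))

  reduction-pendant : ∀ p q j₀ → q j₀ ≡ T → (∀ j → p j ≢ T) → (∀ t → q (punchIn j₀ t) ≢ T) → Reduction p q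
  reduction-pendant p q j₀ qj₀≡T p≢T q≢T = record
    { coeff     = -1^ toℕ j₀ * (c₀ * -1^ n)
    ; reduces   = reduces′
    ; connected = connected′
    }
    where
    open Lowered p q j₀ (p≢T ∘ punchIn j₀) q≢T
    a₀ : Fin (suc n)
    a₀ = lower (p j₀) (p≢T j₀)
    reduces′ : ∀ H → Alternating H → ∀ k →
      boxSum (edgeIntervals k p q) H ≡ -1^ toℕ j₀ * (c₀ * -1^ n) * boxSum (gtIntervals k) H
    reduces′ H alt k =
      begin
        boxSum (edgeIntervals k p q) H
      ≡⟨ boxSum-lowered H alt k ⟩
        -1^ toℕ j₀ * (c₀ * intervalSum (k (p j₀) , k (q j₀)) F)
      ≡⟨ cong (λ I → -1^ toℕ j₀ * (c₀ * intervalSum I F))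
              (cong₂ (λ u w → k u , k w) (sym (inject₁-lower _ (p≢T j₀))) qj₀≡T) ⟩
        -1^ toℕ j₀ * (c₀ * intervalSum (k (inject₁ a₀) , k T) F)
      ≡⟨ cong (λ z → -1^ toℕ j₀ * (c₀ * z)) (boxSum-gtPendant k H alt a₀) ⟩
        -1^ toℕ j₀ * (c₀ * (-1^ n * boxSum (gtIntervals k) H))
      ≡⟨ regroup (-1^ toℕ j₀) c₀ (-1^ n) _ ⟩
        -1^ toℕ j₀ * (c₀ * -1^ n) * boxSum (gtIntervals k) H
      ∎
      where
      open ≡-Reasoning
      F : ℤ → ℤ
      F x = boxSum (gtIntervals (k ∘ inject₁)) (λ v → H (x ∷ v))
      regroup : ∀ a b c d → a * (b * (c * d)) ≡ a * (b * c) * d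
      regroup = solve-∀
    connected′ : -1^ toℕ j₀ * (c₀ * -1^ n) ≢ 0ℤ → Graph.Connected p q
    connected′ c≢0 = connected-via p q (p j₀) reach
      where
      c₀≢0 : c₀ ≢ 0ℤ
      c₀≢0 c₀≡0 = c≢0 (trans (cong (λ z → -1^ toℕ j₀ * (z * -1^ n)) c₀≡0) (ℤP.*-zeroʳ (-1^ toℕ j₀)))
      reach : ∀ u → ∃ λ d → Graph.Walk p q u (p j₀) d
      reach u with u FinP.≟ T
      ... | yes refl = 1 , Graph.cons j₀ (inj₂ (refl , qj₀≡T)) Graph.nil
      ... | no u≢T with lift (proj₂ (connected₀ c₀≢0 (lower u u≢T) a₀))
      ...   | d , walk = d , subst₂ (λ x y → Graph.Walk p q x y d) (inject₁-lower u u≢T) (inject₁-lower _ (p≢T j₀)) walk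

  -- Slide the end of j₁ along j₀ from T to p j₀.
  reduction-slide : ∀ p q {j₀ j₁} → j₁ ≢ j₀ → q j₀ ≡ T → q j₁ ≡ T →
    Reduction p (q [ j₁ ]≔ p j₀) → Reduction p q
  reduction-slide p q {j₀} {j₁} j₁≢j₀ qj₀≡T qj₁≡T R′ = transfer 1ℤ R′ scale simulate
    where
    q′ : Edges
    q′ = q [ j₁ ]≔ p j₀
    scale : ∀ H → Alternating H → ∀ k → boxSum (edgeIntervals k p q) H ≡ 1ℤ * boxSum (edgeIntervals k p q′) H
    scale H alt k =
      begin
        boxSum E H
      ≡⟨ sym (boxSum-set j₁ E H (cong (λ v → k (p j₁) , k v) qj₁≡T)) ⟩
        boxSum (E [ j₁ ]≔ (k (p j₁) , k T)) H
      ≡⟨ boxSum-slideEnd k p q H alt j₁≢j₀ (inj₂ (refl , qj₀≡T)) (k (p j₁)) ⟩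
        boxSum (E [ j₁ ]≔ (k (p j₁) , k (p j₀))) H
      ≡⟨ boxSum-congˡ _ _ H (λ t → sym (edgeIntervals-setEnd k p q j₁ (p j₀) t)) ⟩
        boxSum (edgeIntervals k p q′) H
      ≡⟨ sym (ℤP.*-identityˡ _) ⟩
        1ℤ * boxSum (edgeIntervals k p q′) H
      ∎
      where
      open ≡-Reasoning
      E : Fin (suc n) → Interval
      E = edgeIntervals k p q
    detour : Graph.Walk p q (p j₁) (p j₀) 2
    detour = Graph.cons j₁ (inj₁ (refl , qj₁≡T)) (Graph.cons j₀ (inj₂ (refl , qj₀≡T)) Graph.nil)
    simulate : ∀ e u w → Graph.Joins p q′ e u w → ∃ λ d → Graph.Walk p q u w d
    simulate e u w joins with e FinP.≟ j₁ | joins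
    ... | yes refl | inj₁ (p≡u , q′≡w) =
      2 , subst₂ (λ x y → Graph.Walk p q x y 2) p≡u (trans (sym (VecFP.updateAt-updates j₁ q)) q′≡w) detour
    ... | yes refl | inj₂ (p≡w , q′≡u) =
      2 , subst₂ (λ x y → Graph.Walk p q x y 2) (trans (sym (VecFP.updateAt-updates j₁ q)) q′≡u) p≡w (reverseʷ p q detour)
    ... | no e≢j₁  | inj₁ (p≡u , q′≡w) =
      1 , Graph.cons e (inj₁ (p≡u , trans (sym (VecFP.updateAt-minimal e j₁ q e≢j₁)) q′≡w)) Graph.nil
    ... | no e≢j₁  | inj₂ (p≡w , q′≡u) =
      1 , Graph.cons e (inj₂ (p≡w , trans (sym (VecFP.updateAt-minimal e j₁ q e≢j₁)) q′≡u)) Graph.nil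

  touches : Edges → ℕ
  touches q = ∑[ j < suc n ] indicator (does (q j FinP.≟ T))

  touches-slide : ∀ (q : Edges) {j v} → q j ≡ T → v ≢ T → touches (q [ j ]≔ v) < touches q
  touches-slide q {j} {v} qj≡T v≢T =
    sum-<-atOnePoint (λ t → indicator (does ((q [ j ]≔ v) t FinP.≟ T))) (λ t → indicator (does (q t FinP.≟ T))) j
    (λ t t≢j → cong (λ u → indicator (does (u FinP.≟ T))) (VecFP.updateAt-minimal t j q t≢j))
    (subst₂ (λ a b → indicator a < indicator b)
      (sym (trans (cong (λ u → does (u FinP.≟ T)) (VecFP.updateAt-updates j q)) (Dec.dec-false (v FinP.≟ T) v≢T)))
      (sym (trans (cong (λ u → does (u FinP.≟ T)) qj≡T) (Dec.dec-true (T FinP.≟ T) refl)))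
      (ℕ.s≤s ℕ.z≤n))

  reduction-oriented : ∀ fuel p q → touches q < fuel → (∀ j → p j ≢ T) → Reduction p q
  reduction-oriented (suc fuel) p q touches<fuel p≢T with FinP.any? (λ j → q j FinP.≟ T)
  ... | no untouched = reduction-untouched p q p≢T (λ j qj≡T → untouched (j , qj≡T))
  ... | yes (j₀ , qj₀≡T) with FinP.any? (λ j → Dec.¬? (j FinP.≟ j₀) Dec.×-dec (q j FinP.≟ T))
  ...   | yes (j₁ , j₁≢j₀ , qj₁≡T) = reduction-slide p q j₁≢j₀ qj₀≡T qj₁≡T
            (reduction-oriented fuel p (q [ j₁ ]≔ p j₀)
              (ℕP.<-≤-trans (touches-slide q qj₁≡T (p≢T j₀)) (ℕ.s≤s⁻¹ touches<fuel)) p≢T)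
  ...   | no single = reduction-pendant p q j₀ qj₀≡T p≢T
            (λ t qt≡T → single (punchIn j₀ t , FinP.punchInᵢ≢i j₀ t , qt≡T))

  reduction-loopless : ∀ p q → (∀ j → p j ≢ q j) → Reduction p q
  reduction-loopless p q loopless = transfer ε (reduction-oriented (suc (touches q′)) p′ q′ ℕP.≤-refl p′≢T) scale simulate
    where
    flipped : Fin (suc n) → Bool
    flipped j = does (p j FinP.≟ T)
    p′ q′ : Edges
    p′ j = if flipped j then q j else p j
    q′ j = if flipped j then p j else q j
    p′≢T : ∀ j → p′ j ≢ T
    p′≢T j with p j FinP.≟ T
    ... | yes pj≡T = λ qj≡T → loopless j (trans pj≡T (sym qj≡T))
    ... | no pj≢T  = pj≢T
    ε : ℤ
    ε = -1^ (∑[ j < suc n ] indicator (flipped j))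
    oriented : ∀ k j → edgeIntervals k p q j ≡ (if flipped j then reverse (edgeIntervals k p′ q′ j) else edgeIntervals k p′ q′ j)
    oriented k j with p j FinP.≟ T
    ... | yes _ = refl
    ... | no _  = refl
    scale : ∀ H → Alternating H → ∀ k → boxSum (edgeIntervals k p q) H ≡ ε * boxSum (edgeIntervals k p′ q′) H
    scale H alt k = trans (boxSum-congˡ _ _ H (oriented k)) (boxSum-orient flipped (edgeIntervals k p′ q′) H)
    simulate : ∀ e u w → Graph.Joins p′ q′ e u w → ∃ λ d → Graph.Walk p q u w d
    simulate e u w joins′ = 1 , Graph.cons e (unflip joins′) Graph.nil
      where
      unflip : Graph.Joins p′ q′ e u w → Graph.Joins p q e u w
      unflip joins′ with p e FinP.≟ T | joins′
      ... | yes _ | inj₁ (q≡u , p≡w) = inj₂ (p≡w , q≡u)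
      ... | yes _ | inj₂ (q≡w , p≡u) = inj₁ (p≡u , q≡w)
      ... | no _  | joins            = joins

  reduction-suc : (p q : Edges) → Reduction p q
  reduction-suc p q with FinP.any? (λ j → p j FinP.≟ q j)
  ... | yes (j , loop) = loop-vanishing loop
  ... | no loopless    = reduction-loopless p q (λ j loop → loopless (j , loop))

reduction : ∀ N (p q : Fin N → Fin (suc N)) → Reduction p q
reduction zero    = reduction-zero
reduction (suc n) = ReductionStep.reduction-suc n (reduction n)

-- Counting patterns

gtSum : Vec ℤ (suc N) → (Vec ℤ N → ℤ) → ℤ
gtSum (k ∷ [])       H = H []
gtSum (k₀ ∷ k₁ ∷ ks) H = intervalSum (k₀ , k₁) (λ y → gtSum (k₁ ∷ ks) (λ v → H (y ∷ v)))

boxSum-gt≡gtSum : ∀ (k : Vec ℤ (suc N)) H → boxSum (gtIntervals (lookup k)) H ≡ gtSum k H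
boxSum-gt≡gtSum (k ∷ [])       H = refl
boxSum-gt≡gtSum (k₀ ∷ k₁ ∷ ks) H = intervalSum-cong (k₀ , k₁) (λ y → boxSum-gt≡gtSum (k₁ ∷ ks) _)

gtSum-cong : ∀ (k : Vec ℤ (suc N)) {H G} → (∀ v → H v ≡ G v) → gtSum k H ≡ gtSum k G
gtSum-cong k {H} {G} H≗G = trans (sym (boxSum-gt≡gtSum k H)) (trans (boxSum-congʳ _ H≗G) (boxSum-gt≡gtSum k G))

gtSum-neg : ∀ (k : Vec ℤ (suc N)) H → gtSum k (λ v → - H v) ≡ - gtSum k H
gtSum-neg k H = trans (sym (boxSum-gt≡gtSum k _)) (trans (boxSum-neg _ H) (cong -_ (boxSum-gt≡gtSum k H)))

gtSum-antisym : ∀ (ks : Vec ℤ (suc N)) H → Alternating H → ∀ y z →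
  gtSum ks (λ v → H (y ∷ z ∷ v)) ≡ - gtSum ks (λ v → H (z ∷ y ∷ v))
gtSum-antisym ks H alt y z = trans (gtSum-cong ks (λ v → alt zero (z ∷ y ∷ v))) (gtSum-neg ks _)

gtSum-swap₀ : ∀ k₀ k₁ (ks : Vec ℤ N) H → Alternating H → gtSum (k₁ ∷ k₀ ∷ ks) H ≡ - gtSum (k₀ ∷ k₁ ∷ ks) H
gtSum-swap₀ k₀ k₁ []        H alt = intervalSum-reverse (k₀ , k₁) _
gtSum-swap₀ k₀ k₁ (k₂ ∷ ks) H alt =
  begin
    intervalSum (k₁ , k₀) (λ y → intervalSum (k₀ , k₂) (R y))
  ≡⟨ intervalSum-cong (k₁ , k₀) (λ y → sym (intervalSum-concat k₀ k₁ k₂ (R y))) ⟩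
    intervalSum (k₁ , k₀) (λ y → intervalSum (k₀ , k₁) (R y) + intervalSum (k₁ , k₂) (R y))
  ≡⟨ intervalSum-+ (k₁ , k₀) _ _ ⟩
    intervalSum (k₁ , k₀) (λ y → intervalSum (k₀ , k₁) (R y)) + intervalSum (k₁ , k₀) (λ y → intervalSum (k₁ , k₂) (R y))
  ≡⟨ cong₂ _+_ (trans (intervalSum-reverse (k₀ , k₁) _)
                      (cong -_ (intervalSum²-antisym (k₀ , k₁) R (gtSum-antisym (k₂ ∷ ks) H alt))))
               (intervalSum-reverse (k₀ , k₁) _) ⟩
    - 0ℤ + - intervalSum (k₀ , k₁) (λ y → intervalSum (k₁ , k₂) (R y))
  ≡⟨ ℤP.+-identityˡ _ ⟩
    - intervalSum (k₀ , k₁) (λ y → intervalSum (k₁ , k₂) (R y))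
  ∎
  where
  open ≡-Reasoning
  R : ℤ → ℤ → ℤ
  R y z = gtSum (k₂ ∷ ks) (λ v → H (y ∷ z ∷ v))

gtSum-alternating : ∀ H → Alternating H → Alternating {suc N} (λ k → gtSum k H)
gtSum-alternating H alt zero (k₀ ∷ k₁ ∷ ks) = gtSum-swap₀ k₀ k₁ ks H alt
gtSum-alternating H alt (suc zero) (k₀ ∷ k₁ ∷ k₂ ∷ ks) =
  begin
    intervalSum (k₀ , k₂) tail₂₁
  ≡⟨ intervalSum-cong (k₀ , k₂) (λ y → gtSum-swap₀ k₁ k₂ ks _ (alternating-tail alt y)) ⟩
    intervalSum (k₀ , k₂) (λ y → - tail₁₂ y)
  ≡⟨ intervalSum-neg (k₀ , k₂) tail₁₂ ⟩
    - intervalSum (k₀ , k₂) tail₁₂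
  ≡⟨ cong -_ (sym (intervalSum-concat k₀ k₁ k₂ tail₁₂)) ⟩
    - (intervalSum (k₀ , k₁) tail₁₂ + intervalSum (k₁ , k₂) tail₁₂)
  ≡⟨ cong (λ z → - (intervalSum (k₀ , k₁) tail₁₂ + z))
          (intervalSum²-antisym (k₁ , k₂) R (gtSum-antisym (k₂ ∷ ks) H alt)) ⟩
    - (intervalSum (k₀ , k₁) tail₁₂ + 0ℤ)
  ≡⟨ cong -_ (ℤP.+-identityʳ _) ⟩
    - intervalSum (k₀ , k₁) tail₁₂
  ∎
  where
  open ≡-Reasoning
  tail₂₁ tail₁₂ : ℤ → ℤ
  tail₂₁ y = gtSum (k₂ ∷ k₁ ∷ ks) (λ v → H (y ∷ v))
  tail₁₂ y = gtSum (k₁ ∷ k₂ ∷ ks) (λ v → H (y ∷ v))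
  R : ℤ → ℤ → ℤ
  R y z = gtSum (k₂ ∷ ks) (λ v → H (y ∷ z ∷ v))
gtSum-alternating H alt (suc (suc i)) (k₀ ∷ k₁ ∷ ks) =
  trans (intervalSum-cong (k₀ , k₁) (λ y → gtSum-alternating _ (alternating-tail alt y) (suc i) (k₁ ∷ ks)))
        (intervalSum-neg (k₀ , k₁) _)

indicatorℤ : Bool → ℤ
indicatorℤ true  = 1ℤ
indicatorℤ false = 0ℤ

indicatorℤ-∧ : ∀ a b → indicatorℤ (a ∧ b) ≡ indicatorℤ a * indicatorℤ b
indicatorℤ-∧ true  b = sym (ℤP.*-identityˡ _)
indicatorℤ-∧ false b = refl

rowsMatch : ∀ {n} → MSTuple n → Array → ℤ
rowsMatch A x = indicatorℤ (does (ηrow x ≟rows canonTuple A))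

bottomMatches : ∀ {n} → MS (suc n) → Vec ℤ (suc n) → ℤ
bottomMatches a k = indicatorℤ (does (ListP.≡-dec ℤ._≟_ (canonMS (toList k)) (canonMS (toList a))))

patternCount : (m : ℕ) → Params m → MSTuple (suc m) → Vec ℤ (suc m) → ℤ
patternCount m P A l = signedSum (GGT m l P) (rowsMatch A)

signedSum-prodV : ∀ {N} (I : Fin N → Interval) H →
  signedSum (prodV (Vec.tabulate (λ j → interval (proj₁ (I j)) (proj₂ (I j))))) H ≡ boxSum I H
signedSum-prodV {zero}  I H = trans (cong (ℤ._- 0ℤ) (ℤP.+-identityʳ (H []))) (ℤP.+-identityʳ (H []))
signedSum-prodV {suc N} I H =
  trans (signedSum-prodWith _∷_ (interval (proj₁ (I zero)) (proj₂ (I zero))) _ H)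
        (intervalSum-cong (I zero) (λ x → signedSum-prodV (I ∘ suc) (λ v → H (x ∷ v))))

rowsMatch-snoc : ∀ {n} (A : MSTuple n) a rows (k : Vec ℤ (suc n)) →
  rowsMatch (A , a) (rows ++ (toList k ∷ [])) ≡ bottomMatches a k * rowsMatch A rows
rowsMatch-snoc A a rows k =
  trans (cong (λ x → indicatorℤ (does (x ≟rows _))) (ListP.map-++ canonMS rows (toList k ∷ [])))
        (trans (cong indicatorℤ (does-⇔ (mk⇔ unsnoc snoc) (_ ≟rows _) (bottom? Dec.×-dec (ηrow rows ≟rows canonTuple A))))
               (indicatorℤ-∧ (does bottom?) _))
  where
  bottom? : Dec (canonMS (toList k) ≡ canonMS (toList a))
  bottom? = ListP.≡-dec ℤ._≟_ (canonMS (toList k)) (canonMS (toList a))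
  unsnoc : ηrow rows ++ (canonMS (toList k) ∷ []) ≡ canonTuple A ++ (canonMS (toList a) ∷ []) →
          canonMS (toList k) ≡ canonMS (toList a) × ηrow rows ≡ canonTuple A
  unsnoc eq = proj₂ (ListP.∷ʳ-injective _ _ eq) , proj₁ (ListP.∷ʳ-injective _ _ eq)
  snoc : canonMS (toList k) ≡ canonMS (toList a) × ηrow rows ≡ canonTuple A →
         ηrow rows ++ (canonMS (toList k) ∷ []) ≡ canonTuple A ++ (canonMS (toList a) ∷ [])
  snoc (bottom , upper) = cong₂ (λ u v → u ++ (v ∷ [])) upper bottom

patternCount-suc : ∀ m ps p q (A : MSTuple (suc m)) a k →
  patternCount (suc m) (ps , (p , q)) (A , a) k ≡ bottomMatches a k * boxSum (edgeIntervals (lookup k) p q) (patternCount m ps A)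
patternCount-suc m ps p q A a k =
  begin
    signedSum (mapS (_++ (toList k ∷ [])) (⨆ box (λ l → GGT m l ps))) (rowsMatch (A , a))
  ≡⟨ signedSum-mapS _ (⨆ box (λ l → GGT m l ps)) _ ⟩
    signedSum (⨆ box (λ l → GGT m l ps)) (λ rows → rowsMatch (A , a) (rows ++ (toList k ∷ [])))
  ≡⟨ signedSum-⨆ box (λ l → GGT m l ps) _ ⟩
    signedSum box (λ l → signedSum (GGT m l ps) (λ rows → rowsMatch (A , a) (rows ++ (toList k ∷ []))))
  ≡⟨ signedSum-cong box (λ l → trans (signedSum-cong (GGT m l ps) (λ rows → rowsMatch-snoc A a rows k))
                                     (signedSum-* (GGT m l ps) (bottomMatches a k) (rowsMatch A))) ⟩
    signedSum box (λ l → bottomMatches a k * patternCount m ps A l)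
  ≡⟨ signedSum-* box (bottomMatches a k) (patternCount m ps A) ⟩
    bottomMatches a k * signedSum box (patternCount m ps A)
  ≡⟨ cong (bottomMatches a k *_) (signedSum-prodV (edgeIntervals (lookup k) p q) (patternCount m ps A)) ⟩
    bottomMatches a k * boxSum (edgeIntervals (lookup k) p q) (patternCount m ps A)
  ∎
  where
  open ≡-Reasoning
  box : SSet (Vec ℤ (suc m))
  box = prodV (Vec.tabulate λ j → interval (lookup k (p j)) (lookup k (q j)))

sort-↭-cong : ∀ {xs ys : List ℤ} → xs ↭ ys → sort xs ≡ sort ys
sort-↭-cong {xs} {ys} xs↭ys =
  Pointwise.Pointwise-≡⇒≡ (SortedP.↗↭↗⇒≋ (DecTotalOrder.totalOrder ℤP.≤-decTotalOrder) (sort-↗ xs) (sort-↗ ys)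
    (Perm.↭⇒↭ₛ (Perm.trans (sort-↭ xs) (Perm.trans xs↭ys (Perm.↭-sym (sort-↭ ys))))))

swapAt-↭ : ∀ {N} (i : Fin N) (k : Vec ℤ (suc N)) → toList (swapAt i k) ↭ toList k
swapAt-↭ zero    (x ∷ y ∷ v) = Perm.swap y x Perm.refl
swapAt-↭ (suc i) (x ∷ v)     = Perm.prep x (swapAt-↭ i v)

bottomMatches-swapAt : ∀ {n} (a : MS (suc (suc n))) (i : Fin (suc n)) k → bottomMatches a (swapAt i k) ≡ bottomMatches a k
bottomMatches-swapAt a i k =
  cong (λ xs → indicatorℤ (does (ListP.≡-dec ℤ._≟_ xs (canonMS (toList a))))) (sort-↭-cong (swapAt-↭ i k))

patternCount-alternating : ∀ m P (A : MSTuple (suc m)) → Alternating (patternCount m P A)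
patternCount-alternating zero    P              A       ()
patternCount-alternating (suc m) (ps , (p , q)) (A , a) i k =
  begin
    patternCount (suc m) (ps , (p , q)) (A , a) (swapAt i k)
  ≡⟨ reduced (swapAt i k) ⟩
    bottomMatches a (swapAt i k) * (coeff * gtSum (swapAt i k) H)
  ≡⟨ cong₂ (λ b g → b * (coeff * g)) (bottomMatches-swapAt a i k) (gtSum-alternating H (patternCount-alternating m ps A) i k) ⟩
    bottomMatches a k * (coeff * - gtSum k H)
  ≡⟨ pull-neg (bottomMatches a k) coeff (gtSum k H) ⟩
    - (bottomMatches a k * (coeff * gtSum k H))
  ≡⟨ cong -_ (sym (reduced k)) ⟩
    - patternCount (suc m) (ps , (p , q)) (A , a) k
  ∎
  where
  open ≡-Reasoning
  open Reduction (reduction (suc m) p q)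
  H : Vec ℤ (suc m) → ℤ
  H = patternCount m ps A
  reduced : ∀ k → patternCount (suc m) (ps , (p , q)) (A , a) k ≡ bottomMatches a k * (coeff * gtSum k H)
  reduced k = trans (patternCount-suc m ps p q A a k)
    (cong (bottomMatches a k *_) (trans (reduces H (patternCount-alternating m ps A) (lookup k)) (cong (coeff *_) (boxSum-gt≡gtSum k H))))
  pull-neg : ∀ b c g → b * (c * - g) ≡ - (b * (c * g))
  pull-neg = solve-∀

patternCount-tree : ∀ m P s → TreeSigns m P s → ∀ (A : MSTuple (suc m)) l →
  patternCount m P A l ≡ s * patternCount m (GTParams m) A l
patternCount-tree zero    P              s s≡1 A l = trans (sym (ℤP.*-identityˡ _)) (cong (_* patternCount zero P A l) (sym s≡1))
patternCount-tree (suc m) (ps , (p , q)) s (s₁ , s₂ , signs , level , s≡s₁s₂) (A , a) k =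
  begin
    patternCount (suc m) (ps , (p , q)) (A , a) k
  ≡⟨ patternCount-suc m ps p q A a k ⟩
    bottomMatches a k * boxSum E (patternCount m ps A)
  ≡⟨ cong (bottomMatches a k *_) (trans (boxSum-congʳ E (patternCount-tree m ps s₁ signs A)) (boxSum-* E s₁ G)) ⟩
    bottomMatches a k * (s₁ * boxSum E G)
  ≡⟨ cong (λ z → bottomMatches a k * (s₁ * z))
          (TreeLevel.boxSum-treeLevel m p q s₂ level G (patternCount-alternating m (GTParams m) A) (lookup k)) ⟩
    bottomMatches a k * (s₁ * (s₂ * boxSum (gtIntervals (lookup k)) G))
  ≡⟨ trans (regroup (bottomMatches a k) s₁ s₂ _)
           (cong (_* (bottomMatches a k * boxSum (gtIntervals (lookup k)) G)) (sym s≡s₁s₂)) ⟩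
    s * (bottomMatches a k * boxSum (gtIntervals (lookup k)) G)
  ≡⟨ cong (s *_) (sym (patternCount-suc m (GTParams m) inject₁ suc A a k)) ⟩
    s * patternCount (suc m) (GTParams (suc m)) (A , a) k
  ∎
  where
  open ≡-Reasoning
  E : Fin (suc m) → Interval
  E = edgeIntervals (lookup k) p q
  G : Vec ℤ (suc m) → ℤ
  G = patternCount m (GTParams m) A
  regroup : ∀ b x y d → b * (x * (y * d)) ≡ x * y * (b * d)
  regroup = solve-∀

-- ¬ IsTree does not split constructively into "disconnected or cyclic"; instead decide whether the sum
-- vanishes: if not, the reduction coefficient is non-zero, so the level is connected, and a cycle would
-- kill the sum, so it would be a tree.
patternCount-nonTree : ∀ m P → SomeNonTree m P → ∀ (A : MSTuple (suc m)) l → patternCount m P A l ≡ 0ℤ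
patternCount-nonTree (suc m) (ps , (p , q)) (inj₁ lower) (A , a) k =
  trans (patternCount-suc m ps p q A a k)
        (trans (cong (bottomMatches a k *_) (trans (boxSum-congʳ E (patternCount-nonTree m ps lower A)) (boxSum-zero E)))
               (ℤP.*-zeroʳ (bottomMatches a k)))
  where
  E : Fin (suc m) → Interval
  E = edgeIntervals (lookup k) p q
patternCount-nonTree (suc m) (ps , (p , q)) (inj₂ ¬tree) (A , a) k =
  trans (patternCount-suc m ps p q A a k) (trans (cong (bottomMatches a k *_) vanishes) (ℤP.*-zeroʳ (bottomMatches a k)))
  where
  open Reduction (reduction (suc m) p q)
  H : Vec ℤ (suc m) → ℤ
  H = patternCount m ps A
  alt : Alternating H
  alt = patternCount-alternating m ps A
  vanishes : boxSum (edgeIntervals (lookup k) p q) H ≡ 0ℤ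
  vanishes with boxSum (edgeIntervals (lookup k) p q) H ℤ.≟ 0ℤ
  ... | yes ≡0 = ≡0
  ... | no  ≢0 = contradiction (connected coeff≢0 , λ cycle → ≢0 (boxSum-cycle (lookup k) p q H alt cycle)) ¬tree
    where
    coeff≢0 : coeff ≢ 0ℤ
    coeff≢0 coeff≡0 = ≢0 (trans (reduces H alt (lookup k))
      (trans (cong (_* boxSum (gtIntervals (lookup k)) H) coeff≡0) (ℤP.*-zeroˡ (boxSum (gtIntervals (lookup k)) H))))

signOf : Sign → ℤ
signOf sgn0 = 0ℤ
signOf sgn+ = 1ℤ
signOf sgn- = -1ℤ

patternCount-sign : ∀ m P σ → HasSign m P σ → ∀ (A : MSTuple (suc m)) l →
  patternCount m P A l ≡ signOf σ * patternCount m (GTParams m) A l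
patternCount-sign m P sgn0 nonTree A l = trans (patternCount-nonTree m P nonTree A l) (sym (ℤP.*-zeroˡ (patternCount m (GTParams m) A l)))
patternCount-sign m P sgn+ signs   A l = patternCount-tree m P 1ℤ signs A l
patternCount-sign m P sgn- signs   A l = patternCount-tree m P -1ℤ signs A l

-- Sijections

Uniform : (X → Y) → Y → SSet X → Set
Uniform η c S = All (λ x → η x ≡ c) (S ⁺) × All (λ x → η x ≡ c) (S ⁻)

-- As η is constant on S and T, any bijection between S⁺ ⊔ T⁻ and S⁻ ⊔ T⁺ gives a compatible sijection.
module Balanced (η : X → Y) (c : Y) (S T : SSet X) (S-uniform : Uniform η c S) (T-uniform : Uniform η c T)
                (balanced : length (S ⁺) ℕ.+ length (T ⁻) ≡ length (S ⁻) ℕ.+ length (T ⁺)) where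

  private
    a b c′ d : ℕ
    a  = length (S ⁺)
    b  = length (S ⁻)
    c′ = length (T ⁺)
    d  = length (T ⁻)

  Side : Set
  Side = Fin (a ℕ.+ d) ⊎ Fin (b ℕ.+ c′)

  plus : Fin a ⊎ Fin d → Pt S T
  plus (inj₁ i) = inj₁ (inj₁ i)
  plus (inj₂ i) = inj₂ (inj₂ i)

  minus : Fin b ⊎ Fin c′ → Pt S T
  minus (inj₁ i) = inj₁ (inj₂ i)
  minus (inj₂ i) = inj₂ (inj₁ i)

  encode : Pt S T → Side
  encode (inj₁ (inj₁ i)) = inj₁ (join a d (inj₁ i))
  encode (inj₂ (inj₂ i)) = inj₁ (join a d (inj₂ i))
  encode (inj₁ (inj₂ i)) = inj₂ (join b c′ (inj₁ i))
  encode (inj₂ (inj₁ i)) = inj₂ (join b c′ (inj₂ i))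

  decode : Side → Pt S T
  decode (inj₁ z) = plus (splitAt a z)
  decode (inj₂ z) = minus (splitAt b z)

  decode-encode : ∀ x → decode (encode x) ≡ x
  decode-encode (inj₁ (inj₁ i)) = cong plus (FinP.splitAt-join a d (inj₁ i))
  decode-encode (inj₂ (inj₂ i)) = cong plus (FinP.splitAt-join a d (inj₂ i))
  decode-encode (inj₁ (inj₂ i)) = cong minus (FinP.splitAt-join b c′ (inj₁ i))
  decode-encode (inj₂ (inj₁ i)) = cong minus (FinP.splitAt-join b c′ (inj₂ i))

  encode-decode : ∀ u → encode (decode u) ≡ u
  encode-decode (inj₁ z) = trans (encode-plus (splitAt a z)) (cong inj₁ (FinP.join-splitAt a d z))
    where
    encode-plus : ∀ s → encode (plus s) ≡ inj₁ (join a d s)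
    encode-plus (inj₁ i) = refl
    encode-plus (inj₂ i) = refl
  encode-decode (inj₂ z) = trans (encode-minus (splitAt b z)) (cong inj₂ (FinP.join-splitAt b c′ z))
    where
    encode-minus : ∀ s → encode (minus s) ≡ inj₂ (join b c′ s)
    encode-minus (inj₁ i) = refl
    encode-minus (inj₂ i) = refl

  cross : Side → Side
  cross (inj₁ z) = inj₂ (cast balanced z)
  cross (inj₂ z) = inj₁ (cast (sym balanced) z)

  cross-involutive : ∀ u → cross (cross u) ≡ u
  cross-involutive (inj₁ z) = cong inj₁ (FinP.cast-involutive (sym balanced) balanced z)
  cross-involutive (inj₂ z) = cong inj₂ (FinP.cast-involutive balanced (sym balanced) z)

  isPlus : Side → Bool
  isPlus (inj₁ _) = true
  isPlus (inj₂ _) = false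

  inPlusSide-encode : ∀ x → inPlusSide {S = S} {T} x ≡ isPlus (encode x)
  inPlusSide-encode (inj₁ (inj₁ i)) = refl
  inPlusSide-encode (inj₂ (inj₂ i)) = refl
  inPlusSide-encode (inj₁ (inj₂ i)) = refl
  inPlusSide-encode (inj₂ (inj₁ i)) = refl

  isPlus-cross : ∀ u → isPlus (cross u) ≡ not (isPlus u)
  isPlus-cross (inj₁ _) = refl
  isPlus-cross (inj₂ _) = refl

  φ : Pt S T → Pt S T
  φ x = decode (cross (encode x))

  φ-involutive : ∀ x → φ (φ x) ≡ x
  φ-involutive x = trans (cong (decode ∘′ cross) (encode-decode (cross (encode x))))
                         (trans (cong decode (cross-involutive (encode x))) (decode-encode x))
    where open import Function using (_∘′_)

  φ-switches : ∀ x → inPlusSide {S = S} {T} (φ x) ≡ not (inPlusSide {S = S} {T} x)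
  φ-switches x = trans (inPlusSide-encode (φ x))
    (trans (cong isPlus (encode-decode (cross (encode x))))
           (trans (isPlus-cross (encode x)) (cong not (sym (inPlusSide-encode x)))))

  value : ∀ x → η (val S T x) ≡ c
  value (inj₁ (inj₁ i)) = All.lookup (proj₁ S-uniform) (∈-lookup i)
  value (inj₁ (inj₂ i)) = All.lookup (proj₂ S-uniform) (∈-lookup i)
  value (inj₂ (inj₁ i)) = All.lookup (proj₁ T-uniform) (∈-lookup i)
  value (inj₂ (inj₂ i)) = All.lookup (proj₂ T-uniform) (∈-lookup i)

  sijection : CompatSijection η S T
  sijection = record
    { φ          = φ
    ; involutive = φ-involutive
    ; maps-into  = λ x plus → trans (φ-switches x) (cong not plus)
    ; onto       = λ y minus → φ y , trans (φ-switches y) (cong not minus) , φ-involutive y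
    ; compatible = λ x → trans (value (φ x)) (sym (value x))
    }

witness : {A : Set} (d : Dec A) → IsTrue (does d) → A
witness (yes a) _ = a

restrictRow-uniform : ∀ (S : SSet Array) {n} (A : MSTuple n) → Uniform ηrow (canonTuple A) (restrictRow S A)
restrictRow-uniform (P , N) A = All.map uniform (all-filter _ P) , All.map uniform (all-filter _ N)
  where
  uniform : ∀ {x} → IsTrue (does (ηrow x ≟rows canonTuple A)) → ηrow x ≡ canonTuple A
  uniform {x} = witness (ηrow x ≟rows canonTuple A)

signedBy-uniform : ∀ σ {R : SSet Array} {c} → Uniform ηrow c R → Uniform ηrow c (signedBy σ R)
signedBy-uniform sgn0 _                = All.[] , All.[]
signedBy-uniform sgn+ R-uniform        = R-uniform
signedBy-uniform sgn- (plus , minus)   = minus , plus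

signedCard : SSet X → ℤ
signedCard (P , N) = + length P - + length N

length-filterᵇ : ∀ (P : X → Bool) xs → + length (filterᵇ P xs) ≡ listSum xs (indicatorℤ ∘ P)
length-filterᵇ P []       = refl
length-filterᵇ P (x ∷ xs) with P x
... | true  = cong (_+_ 1ℤ) (length-filterᵇ P xs)
... | false = trans (length-filterᵇ P xs) (sym (ℤP.+-identityˡ _))

signedCard-restrictRow : ∀ (S : SSet Array) {n} (A : MSTuple n) → signedCard (restrictRow S A) ≡ signedSum S (rowsMatch A)
signedCard-restrictRow (P , N) A = cong₂ _-_ (length-filterᵇ _ P) (length-filterᵇ _ N)

signedCard-signedBy : ∀ σ (R : SSet Array) → signedCard (signedBy σ R) ≡ signOf σ * signedCard R
signedCard-signedBy sgn0 R       = refl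
signedCard-signedBy sgn+ R       = sym (ℤP.*-identityˡ _)
signedCard-signedBy sgn- (P , N) = flip (+ length P) (+ length N)
  where
  flip : ∀ a b → b - a ≡ -1ℤ * (a - b)
  flip = solve-∀

balanced : ∀ (S T : SSet X) → signedCard S ≡ signedCard T → length (S ⁺) ℕ.+ length (T ⁻) ≡ length (S ⁻) ℕ.+ length (T ⁺)
balanced (SP , SN) (TP , TN) eq = ℤP.+-injective (begin
    + (a ℕ.+ d)
  ≡⟨ ℤP.pos-+ a d ⟩
    + a + + d
  ≡⟨ shift (+ a) (+ b) (+ d) ⟩
    (+ a - + b) + (+ b + + d)
  ≡⟨ cong (_+ (+ b + + d)) eq ⟩
    (+ c - + d) + (+ b + + d)
  ≡⟨ unshift (+ c) (+ d) (+ b) ⟩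
    + b + + c
  ≡⟨ sym (ℤP.pos-+ b c) ⟩
    + (b ℕ.+ c)
  ∎)
  where
  open ≡-Reasoning
  a b c d : ℕ
  a = length SP
  b = length SN
  c = length TP
  d = length TN
  shift : ∀ a b d → a + d ≡ (a - b) + (b + d)
  shift = solve-∀
  unshift : ∀ c d b → (c - d) + (b + d) ≡ b + c
  unshift = solve-∀

mainTheorem4 : (m : ℕ) (k : Vec ℤ (suc m)) (P : Params m) (A : MSTuple (suc m)) →
    toList (lastMS A) ↭ toList k →
    (σ : Sign) → HasSign m P σ →
    CompatSijection ηrow (restrictRow (GGT m k P) A) (signedBy σ (restrictRow (GT m k) A))
mainTheorem4 m k P A _ σ hasSign =
  Balanced.sijection ηrow (canonTuple A) S T
    (restrictRow-uniform (GGT m k P) A) (signedBy-uniform σ (restrictRow-uniform (GT m k) A)) (balanced S T equal)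
  where
  open ≡-Reasoning
  S T : SSet Array
  S = restrictRow (GGT m k P) A
  T = signedBy σ (restrictRow (GT m k) A)
  equal : signedCard S ≡ signedCard T
  equal = begin
      signedCard S
    ≡⟨ signedCard-restrictRow (GGT m k P) A ⟩
      patternCount m P A k
    ≡⟨ patternCount-sign m P σ hasSign A k ⟩
      signOf σ * patternCount m (GTParams m) A k
    ≡⟨ cong (signOf σ *_) (sym (signedCard-restrictRow (GT m k) A)) ⟩
      signOf σ * signedCard (restrictRow (GT m k) A)
    ≡⟨ sym (signedCard-signedBy σ (restrictRow (GT m k) A)) ⟩
      signedCard T
    ∎
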